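{- Let $W,W'$ be injective words over $\overline{\mathbb{Z}}$. Then $W\sim W'$ if and only if $W=UabV$ and $W'=UbaV$ for some words $U,V$ and letters $a,b\in\overline{\mathbb{Z}}$ such that there exist $r_1<r_2$ in $\mathrm{rl}(U)$ with $a<r_1<r_2<b$ or $b<r_1<r_2<a$.
   Context: $\overline{\mathbb{Z}}$ is the set of symbols $(i,j)$, $i\in\mathbb{Z}$, $j\ge1$, with $\mathrm{val}(i,j)=i$. Let $\underline{\mathbb{Z}}=\{\underline{i}:i\in\mathbb{Z}\}$, and totally order $\overline{\mathbb{Z}}\sqcup\underline{\mathbb{Z}}$ by $\underline{i}<(i,1)<(i,2)<\cdots<\underline{i+1}$. Indexed forests: for finite $S\subset\mathbb{Z}$ with maximal consecutive blocks $I_1<\cdots<I_k$, an indexed forest with support $S$ is a tuple of plane binary trees $T_j$ with $|I_j|$ nodes, canonically labeled by $I_j$ in inorder. A decreasing labeling of $F$ is a bijection from the nodes to $\{1,\dots,|F|\}$ in which every node has a larger label than its children. Insertion $W\mapsto(F(W),P(W),Q(W))$ for injective words: for $W$ empty, $F(W)$ is empty. For $W=W'a$, let $F'=F(W')$ have blocks $I_1<\cdots<I_k$, roots $u_j$ and root labels $a_j=P(W')(u_j)$, and let $i=\mathrm{val}(a)$. Add a new root $u$ as follows. (i) If $i\notin\mathrm{Supp}(F')$: $u$ has canonical label $i$, left child $u_j$ if $i-1\in I_j$, and right child $u_{j'}$ if $i+1\in I_{j'}$ (else no such child). (ii) If $i\in I_j$ and $a>a_j$: the left child is $u_j$, the right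 child is $u_{j+1}$ if $\max I_j+2\in\mathrm{Supp}(F')$, and the support gains $\max I_j+1$. (iii) If $i\in I_j$ and $a<a_j$: the right child is $u_j$, the left child is $u_{j-1}$ if $\min I_j-2\in\mathrm{Supp}(F')$, and the support gains $\min I_j-1$. $P(W)$ extends $P(W')$ by $u\mapsto a$, and $Q(W)$ extends $Q(W')$ by $u\mapsto|W|$. Define $W\sim W'$ if $P(W)=P(W')$ and $Q(W')$ is obtained from $Q(W)$ by swapping labels $i,i+1$ (for some $i$) carried by two nodes neither of which is a descendant of the other. The rootlist $\mathrm{rl}(U)$ of a word $U$ is the totally ordered subset of $\overline{\mathbb{Z}}\sqcup\underline{\mathbb{Z}}$ consisting of the labels $P(U)(r)$ of all roots $r$ of $F(U)$, together with all $\underline{i}$ such that $i-1\notin\mathrm{Supp}(F(U))$ and $i\notin\mathrm{Supp}(F(U))$. -}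

module Defs where

open import Data.Nat as ℕ using (ℕ; zero; suc)
open import Data.Integer as Z using (ℤ)
open import Data.Bool using (Bool; true; false; if_then_else_; _∧_; _∨_)
open import Data.Maybe using (Maybe; just; nothing; maybe)
open import Data.List using (List; []; _∷_; _++_; [_])
open import Data.List.Relation.Unary.Any using (Any)
open import Data.List.Membership.Propositional using (_∈_)
open import Data.Product using (_×_; _,_; proj₁; proj₂; ∃; Σ)
open import Data.Sum using (_⊎_)
open import Relation.Nullary using (¬_; yes; no)
open import Relation.Nullary.Decidable using (⌊_⌋)
open import Relation.Binary.PropositionalEquality using (_≡_)

-- Letters of \overline{ℤ}: the symbol (i , j) with j ≥ 1 is encoded as
-- mkL i k with j = suc k.  val (i , j) = i.

record Letter : Set where
  constructor mkL
  field
    val : ℤ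
    idx : ℕ
open Letter public

_<L_ : Letter → Letter → Set
a <L b = (val a Z.< val b) ⊎ ((val a ≡ val b) × (idx a ℕ.< idx b))

ltL : Letter → Letter → Bool
ltL a b = ⌊ val a Z.<? val b ⌋ ∨ (⌊ val a Z.≟ val b ⌋ ∧ ⌊ idx a ℕ.<? idx b ⌋)

data Ext : Set where
  over  : Letter → Ext
  under : ℤ → Ext

-- \underline{i} < (i,1) < (i,2) < ... < \underline{i+1}
_<E_ : Ext → Ext → Set
over a  <E over b   = a <L b
over a  <E under k  = val a Z.< k
under k <E over b   = k Z.≤ val b
under k <E under k' = k Z.< k'

-- A node carries its P-label (a letter) and
-- its Q-label (a natural number).  Canonical labels are not stored: a
-- block stores its minimal canonical label 'lo', and the canonical labels
-- of its nodes are lo, lo+1, ... in inorder.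

data Tree : Set where
  leaf : Tree
  node : Tree → Letter → ℕ → Tree → Tree

record Block : Set where
  constructor blk
  field
    lo  : ℤ
    L   : Tree
    lab : Letter   -- P-label of the root
    stp : ℕ        -- Q-label of the root
    R   : Tree
open Block public

tree : Block → Tree
tree b = node (L b) (lab b) (stp b) (R b)

size : Tree → ℕ
size leaf = 0
size (node l _ _ r) = size l ℕ.+ suc (size r)

hi : Block → ℤ
hi b = (lo b Z.+ Z.+ size (tree b)) Z.- Z.1ℤ

-- forests are lists of blocks in increasing order I₁ < ... < I_k
Forest : Set
Forest = List Block

extractHi : ℤ → Forest → Maybe Block × Forest
extractHi h [] = nothing , []
extractHi h (b ∷ bs) with hi b Z.≟ h
... | yes _ = just b , bs
... | no _  = proj₁ (extractHi h bs) , b ∷ proj₂ (extractHi h bs)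

extractLo : ℤ → Forest → Maybe Block × Forest
extractLo h [] = nothing , []
extractLo h (b ∷ bs) with lo b Z.≟ h
... | yes _ = just b , bs
... | no _  = proj₁ (extractLo h bs) , b ∷ proj₂ (extractLo h bs)

insertBlock : Block → Forest → Forest
insertBlock b [] = [ b ]
insertBlock b (c ∷ cs) with lo b Z.<? lo c
... | yes _ = b ∷ c ∷ cs
... | no _  = c ∷ insertBlock b cs

-- add a new root with canonical label g (g ∉ Supp), P-label a and
-- Q-label n; its left child is the root of the block ending at g-1 (if
-- any) and its right child the root of the block starting at g+1 (if any).
joinAt : ℤ → Letter → ℕ → Forest → Forest
joinAt g a n F =
  let ml = proj₁ (extractHi (g Z.- Z.1ℤ) F)
      F₁ = proj₂ (extractHi (g Z.- Z.1ℤ) F)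
      mr = proj₁ (extractLo (g Z.+ Z.1ℤ) F₁)
      F₂ = proj₂ (extractLo (g Z.+ Z.1ℤ) F₁)
  in insertBlock (blk (maybe lo g ml) (maybe tree leaf ml) a n (maybe tree leaf mr)) F₂

findBlock : ℤ → Forest → Maybe Block
findBlock i [] = nothing
findBlock i (b ∷ bs) =
  if ⌊ lo b Z.≤? i ⌋ ∧ ⌊ i Z.≤? hi b ⌋ then just b else findBlock i bs

step : Letter → ℕ → Forest → Forest
step a n F with findBlock (val a) F
... | nothing = joinAt (val a) a n F
... | just b  = if ltL (lab b) a
                  then joinAt (hi b Z.+ Z.1ℤ) a n F
                  else joinAt (lo b Z.- Z.1ℤ) a n F

insGo : ℕ → Forest → List Letter → Forest
insGo n F [] = F
insGo n F (a ∷ as) = insGo (suc n) (step a n F) as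

-- (F(W), P(W), Q(W)) as one decorated forest; the k-th letter gets Q-label k
ins : List Letter → Forest
ins W = insGo 1 [] W

mapQT : (ℕ → ℕ) → Tree → Tree
mapQT f leaf = leaf
mapQT f (node l a q r) = node (mapQT f l) a (f q) (mapQT f r)

mapQB : (ℕ → ℕ) → Block → Block
mapQB f (blk lo l a q r) = blk lo (mapQT f l) a (f q) (mapQT f r)

mapQ : (ℕ → ℕ) → Forest → Forest
mapQ f [] = []
mapQ f (b ∷ bs) = mapQB f b ∷ mapQ f bs

swapN : ℕ → ℕ → ℕ → ℕ
swapN k m x = if ⌊ x ℕ.≟ k ⌋ then m else (if ⌊ x ℕ.≟ m ⌋ then k else x)

qlabels : Tree → List ℕ
qlabels leaf = []
qlabels (node l _ q r) = qlabels l ++ (q ∷ qlabels r)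

qlabelsF : Forest → List ℕ
qlabelsF [] = []
qlabelsF (b ∷ bs) = qlabels (tree b) ++ qlabelsF bs

data DescT (x y : ℕ) : Tree → Set where
  here : ∀ {l a q r} → q ≡ x → y ∈ (qlabels l ++ qlabels r) → DescT x y (node l a q r)
  inl  : ∀ {l a q r} → DescT x y l → DescT x y (node l a q r)
  inr  : ∀ {l a q r} → DescT x y r → DescT x y (node l a q r)

DescF : ℕ → ℕ → Forest → Set
DescF x y F = Any (λ b → DescT x y (tree b)) F

_∼_ : List Letter → List Letter → Set
W ∼ W' = ∃ λ k →
    (k ∈ qlabelsF (ins W)) × (suc k ∈ qlabelsF (ins W))
  × ¬ DescF k (suc k) (ins W) × ¬ DescF (suc k) k (ins W)
  × (ins W' ≡ mapQ (swapN k (suc k)) (ins W))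

InSupp : ℤ → Forest → Set
InSupp i F = Any (λ b → (lo b Z.≤ i) × (i Z.≤ hi b)) F

InRL : List Letter → Ext → Set
InRL U e =
    Any (λ b → e ≡ over (lab b)) (ins U)
  ⊎ Σ ℤ (λ i → (e ≡ under i) × ¬ InSupp (i Z.- Z.1ℤ) (ins U) × ¬ InSupp i (ins U))

module Submission where

-- Inserting a letter x only changes the forest around its target: the free
-- cell that receives the new root (val x itself, or the cell just past the
-- block containing val x, on the side dictated by comparing x with that
-- block's root label).  If a free cell f separates the targets of a and b,
-- the insertions of a and b act on opposite sides of f, so inserting ab and
-- ba produce the same forest up to exchanging the Q-labels of the two new
-- roots, which are then incomparable; the insertion of V respects this
-- relabelling.  Conversely, if the Q-labels k, k+1 may be exchanged, they
-- belong to consecutive letters a b of W, and after inserting a either the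
-- root of b adopts the new block of a as a child, or the free cell next to
-- that block on the side of b separates the two targets.  Free cells
-- strictly between the targets of a and b are exactly what a pair
-- r₁ < r₂ of rl(U) strictly between a and b provides.

open import Defs
open import Data.Nat as ℕ using (ℕ; zero; suc)
import Data.Nat.Properties as NP
open import Data.Integer as Z using (ℤ; _+_; _-_; 1ℤ; _≤_; _<_; +_)
import Data.Integer.Properties as ZP
open import Data.Integer.Tactic.RingSolver
open import Data.Bool using (true; false; if_then_else_)
open import Data.Maybe using (Maybe; just; nothing; maybe)
import Data.Maybe as M
open import Data.List using (List; []; _∷_; _++_; map; length)
open import Data.List.Properties using (map-++; ++-assoc)
open import Data.List.Relation.Unary.Any using (Any; here; there)
open import Data.List.Relation.Unary.All using (All; []; _∷_)
import Data.List.Relation.Unary.All as All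
open import Data.List.Relation.Unary.AllPairs using (AllPairs; []; _∷_)
open import Data.List.Relation.Unary.Unique.Propositional using (Unique)
open import Data.List.Membership.Propositional using (_∈_; find; lose)
open import Data.List.Membership.Propositional.Properties using (∈-map⁺; ∈-map⁻; ∈-++⁺ˡ; ∈-++⁺ʳ; ∈-++⁻; ∈-insert)
open import Data.Product using (_×_; _,_; proj₁; proj₂; ∃; Σ)
open import Data.Sum using (_⊎_; inj₁; inj₂)
open import Data.Empty using (⊥; ⊥-elim)
open import Relation.Nullary using (¬_; yes; no)
open import Relation.Binary using (tri<; tri≈; tri>)
open import Relation.Binary.PropositionalEquality
open import Function.Bundles using (_⇔_; mk⇔)

<⇒+1≤ : ∀ {i j} → i < j → i + 1ℤ ≤ j
<⇒+1≤ {i} {j} p = subst (_≤ j) (ZP.+-comm 1ℤ i) (ZP.i<j⇒suc[i]≤j p)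

+1≤⇒< : ∀ {i j} → i + 1ℤ ≤ j → i < j
+1≤⇒< {i} {j} p = ZP.suc[i]≤j⇒i<j (subst (_≤ j) (ZP.+-comm i 1ℤ) p)

+1-1 : ∀ i → (i + 1ℤ) - 1ℤ ≡ i
+1-1 = solve-∀
-1+1 : ∀ i → (i - 1ℤ) + 1ℤ ≡ i
-1+1 = solve-∀

i<i+1 : ∀ i → i < i + 1ℤ
i<i+1 i = +1≤⇒< ZP.≤-refl

i-1<i : ∀ i → i - 1ℤ < i
i-1<i i = +1≤⇒< (ZP.≤-reflexive (-1+1 i))

<⇒≤-1 : ∀ {i j} → i < j → i ≤ j - 1ℤ
<⇒≤-1 {i} {j} p = subst (_≤ j - 1ℤ) (+1-1 i) (ZP.+-monoˡ-≤ (Z.- 1ℤ) (<⇒+1≤ p))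

≤-1⇒< : ∀ {i j} → i ≤ j - 1ℤ → i < j
≤-1⇒< {i} {j} p = ZP.≤-<-trans p (i-1<i j)

≤⇒<+1 : ∀ {i j} → i ≤ j → i < j + 1ℤ
≤⇒<+1 {i} {j} p = ZP.≤-<-trans p (i<i+1 j)

<+1⇒≤ : ∀ {i j} → i < j + 1ℤ → i ≤ j
<+1⇒≤ {i} {j} p = subst (i ≤_) (+1-1 j) (<⇒≤-1 p)

trichotomy : ∀ i j → (i < j) ⊎ (i ≡ j) ⊎ (j < i)
trichotomy i j with ZP.<-cmp i j
... | tri< a _ _ = inj₁ a
... | tri≈ _ b _ = inj₂ (inj₁ b)
... | tri> _ _ c = inj₂ (inj₂ c)

i<i+suc : ∀ (l : ℤ) n → l < l + + suc n
i<i+suc l n = subst (_< l + + suc n) (ZP.+-identityʳ l) (ZP.+-monoʳ-< l (Z.+<+ (ℕ.s≤s ℕ.z≤n)))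

just≢nothing : ∀ {A : Set} {x : A} → just x ≡ nothing → ⊥
just≢nothing ()

∈-drop-mid : ∀ {A : Set} {c l : A} xs ys → c ∈ xs ++ l ∷ ys → ¬ (c ≡ l) → c ∈ xs ++ ys
∈-drop-mid [] ys (here e) ne = ⊥-elim (ne e)
∈-drop-mid [] ys (there m) ne = m
∈-drop-mid (x ∷ xs) ys (here e) ne = here e
∈-drop-mid (x ∷ xs) ys (there m) ne = there (∈-drop-mid xs ys m ne)

∈-add-mid : ∀ {A : Set} {c l : A} xs ys → c ∈ xs ++ ys → c ∈ xs ++ l ∷ ys
∈-add-mid [] ys m = there m
∈-add-mid (x ∷ xs) ys (here e) = here e
∈-add-mid (x ∷ xs) ys (there m) = there (∈-add-mid xs ys m)

All-drop-mid : ∀ {A : Set} {P : A → Set} {l} xs ys → All P (xs ++ l ∷ ys) → All P (xs ++ ys)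
All-drop-mid [] ys (_ ∷ ps) = ps
All-drop-mid (x ∷ xs) ys (p ∷ ps) = p ∷ All-drop-mid xs ys ps

AllPairs-drop-mid : ∀ {A : Set} {R : A → A → Set} {l} xs ys → AllPairs R (xs ++ l ∷ ys) → AllPairs R (xs ++ ys)
AllPairs-drop-mid [] ys (_ ∷ ps) = ps
AllPairs-drop-mid (x ∷ xs) ys (p ∷ ps) = All-drop-mid xs ys p ∷ AllPairs-drop-mid xs ys ps

AllPairs-mid : ∀ {A : Set} {R : A → A → Set} {l} xs ys → AllPairs R (xs ++ l ∷ ys) → All (R l) ys
AllPairs-mid [] ys (p ∷ _) = p
AllPairs-mid (x ∷ xs) ys (_ ∷ ps) = AllPairs-mid xs ys ps

<L-irrefl : ∀ {a} → ¬ (a <L a)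
<L-irrefl (inj₁ p) = ZP.<-irrefl refl p
<L-irrefl (inj₂ (_ , p)) = NP.<-irrefl refl p

<L-trans : ∀ {a b c} → a <L b → b <L c → a <L c
<L-trans (inj₁ p) (inj₁ q) = inj₁ (ZP.<-trans p q)
<L-trans (inj₁ p) (inj₂ (q , _)) = inj₁ (subst (_ <_) q p)
<L-trans (inj₂ (p , _)) (inj₁ q) = inj₁ (subst (_< _) (sym p) q)
<L-trans (inj₂ (p , p')) (inj₂ (q , q')) = inj₂ (trans p q , NP.<-trans p' q')

<L⇒val≤ : ∀ {a b} → a <L b → val a ≤ val b
<L⇒val≤ (inj₁ p) = ZP.<⇒≤ p
<L⇒val≤ (inj₂ (p , _)) = ZP.≤-reflexive p

ltL-true⇒<L : ∀ a b → ltL a b ≡ true → a <L b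
ltL-true⇒<L a b e with val a Z.<? val b | val a Z.≟ val b | idx a ℕ.<? idx b
ltL-true⇒<L a b e  | yes p | _     | _     = inj₁ p
ltL-true⇒<L a b e  | no _  | yes p | yes q = inj₂ (p , q)
ltL-true⇒<L a b () | no _  | yes _ | no _
ltL-true⇒<L a b () | no _  | no _  | _

ltL-false⇒≮L : ∀ a b → ltL a b ≡ false → ¬ (a <L b)
ltL-false⇒≮L a b e lt with val a Z.<? val b | val a Z.≟ val b | idx a ℕ.<? idx b
ltL-false⇒≮L a b () lt | yes p | _ | _
ltL-false⇒≮L a b () lt | no _ | yes p | yes q
ltL-false⇒≮L a b e (inj₁ x) | no np | _ | _ = np x
ltL-false⇒≮L a b e (inj₂ (x , y)) | no _ | yes p | no nq = nq y
ltL-false⇒≮L a b e (inj₂ (x , y)) | no _ | no np | _ = np x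

mkL-≡ : ∀ {a b} → val a ≡ val b → idx a ≡ idx b → a ≡ b
mkL-≡ {mkL v i} {mkL .v .i} refl refl = refl

≮L∧≢⇒>L : ∀ a b → ¬ (a <L b) → ¬ (a ≡ b) → b <L a
≮L∧≢⇒>L a b n ne with trichotomy (val a) (val b)
... | inj₁ p = ⊥-elim (n (inj₁ p))
... | inj₂ (inj₂ p) = inj₁ p
... | inj₂ (inj₁ p) with NP.<-cmp (idx a) (idx b)
... | tri< x _ _ = ⊥-elim (n (inj₂ (p , x)))
... | tri≈ _ x _ = ⊥-elim (ne (mkL-≡ p x))
... | tri> _ _ x = inj₂ (sym p , x)

ltL-true⊎false : ∀ a b → ltL a b ≡ true ⊎ ltL a b ≡ false
ltL-true⊎false a b with ltL a b
... | true = inj₁ refl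
... | false = inj₂ refl

<L⇒ltL-true : ∀ a b → a <L b → ltL a b ≡ true
<L⇒ltL-true a b p with ltL-true⊎false a b
... | inj₁ e = e
... | inj₂ e = ⊥-elim (ltL-false⇒≮L a b e p)

>L⇒ltL-false : ∀ a b → b <L a → ltL a b ≡ false
>L⇒ltL-false a b p with ltL-true⊎false a b
... | inj₁ e = ⊥-elim (<L-irrefl (<L-trans p (ltL-true⇒<L a b e)))
... | inj₂ e = e

record In (i : ℤ) (c : Block) : Set where
  constructor mkIn
  field
    inlo : lo c ≤ i
    inhi : i ≤ hi c
open In public

record Sep (c d : Block) : Set where
  constructor mkSep
  field
    gap : hi c + 1ℤ < lo d

LabelIn : Block → Set
LabelIn c = In (val (lab c)) c

WellFormed : Forest → Set
WellFormed F = AllPairs Sep F × All LabelIn F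

Free : ℤ → Forest → Set
Free i F = ¬ InSupp i F

size-tree≡suc : ∀ c → Σ ℕ (λ m → size (tree c) ≡ suc m)
size-tree≡suc c = size (L c) ℕ.+ size (R c) , NP.+-suc (size (L c)) (size (R c))

lo≤hi : ∀ c → lo c ≤ hi c
lo≤hi c with size-tree≡suc c
... | m , eq rewrite eq = <⇒≤-1 (i<i+suc (lo c) m)

Sep-irrefl : ∀ {c} → ¬ Sep c c
Sep-irrefl {c} (mkSep s) = ZP.<⇒≱ (ZP.≤-<-trans (lo≤hi c) (i<i+1 (hi c))) (ZP.<⇒≤ s)

Sep-disjoint : ∀ {c d i} → Sep c d → In i c → In i d → ⊥
Sep-disjoint {c} {d} (mkSep s) (mkIn _ ic) (mkIn id _) = ZP.<⇒≱ (ZP.<-trans (≤⇒<+1 ic) s) id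

Sep⇒lo< : ∀ {c d} → Sep c d → lo c < lo d
Sep⇒lo< {c} {d} (mkSep s) = ZP.≤-<-trans (lo≤hi c) (ZP.<-trans (i<i+1 (hi c)) s)

Sep-trichotomy : ∀ {F c d} → AllPairs Sep F → c ∈ F → d ∈ F → (c ≡ d) ⊎ Sep c d ⊎ Sep d c
Sep-trichotomy (x ∷ ap) (here refl) (here refl) = inj₁ refl
Sep-trichotomy (x ∷ ap) (here refl) (there m) = inj₂ (inj₁ (All.lookup x m))
Sep-trichotomy (x ∷ ap) (there m) (here refl) = inj₂ (inj₂ (All.lookup x m))
Sep-trichotomy (x ∷ ap) (there m) (there n) = Sep-trichotomy ap m n

In-unique : ∀ {F c d i} → AllPairs Sep F → c ∈ F → d ∈ F → In i c → In i d → c ≡ d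
In-unique {F} {c} {d} ap m n ic id with Sep-trichotomy ap m n
... | inj₁ e = e
... | inj₂ (inj₁ s) = ⊥-elim (Sep-disjoint {c} {d} s ic id)
... | inj₂ (inj₂ s) = ⊥-elim (Sep-disjoint {d} {c} s id ic)

InSupp⇒In : ∀ {i F} → InSupp i F → Σ Block (λ c → c ∈ F × In i c)
InSupp⇒In s with find s
... | c , m , (p , q) = c , m , mkIn p q

In⇒InSupp : ∀ {i F c} → c ∈ F → In i c → InSupp i F
In⇒InSupp m (mkIn p q) = lose m (p , q)

findBlock-just : ∀ i F {c} → findBlock i F ≡ just c → c ∈ F × In i c
findBlock-just i (b ∷ bs) e with lo b Z.≤? i | i Z.≤? hi b
findBlock-just i (b ∷ bs) refl | yes p | yes q = here refl , mkIn p q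
... | yes p | no _ = let (m , r) = findBlock-just i bs e in there m , r
... | no _ | _ = let (m , r) = findBlock-just i bs e in there m , r

findBlock-nothing : ∀ i F → findBlock i F ≡ nothing → Free i F
findBlock-nothing i [] e ()
findBlock-nothing i (b ∷ bs) e s with lo b Z.≤? i | i Z.≤? hi b
findBlock-nothing i (b ∷ bs) () s | yes p | yes q
findBlock-nothing i (b ∷ bs) e (here (p , q)) | yes _ | no nq = nq q
findBlock-nothing i (b ∷ bs) e (there s) | yes _ | no nq = findBlock-nothing i bs e s
findBlock-nothing i (b ∷ bs) e (here (p , q)) | no np | _ = np p
findBlock-nothing i (b ∷ bs) e (there s) | no np | _ = findBlock-nothing i bs e s

findBlock-view : ∀ i F → (Σ Block λ c → findBlock i F ≡ just c) ⊎ (findBlock i F ≡ nothing)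
findBlock-view i F with findBlock i F
... | just c = inj₁ (c , refl)
... | nothing = inj₂ refl

findBlock-complete : ∀ {i F c} → AllPairs Sep F → c ∈ F → In i c → findBlock i F ≡ just c
findBlock-complete {i} {F} {c} ap m ic with findBlock-view i F
... | inj₁ (d , e) = let (m' , id) = findBlock-just i F e in
                      trans e (cong just (In-unique ap m' m id ic))
... | inj₂ e = ⊥-elim (findBlock-nothing i F e (In⇒InSupp m ic))

targetNear : Letter → Block → ℤ
targetNear a b = if ltL (lab b) a then hi b + 1ℤ else lo b - 1ℤ

-- The canonical label of the new root when a is inserted into F: val a in
-- case (i), the cell just past the block containing val a in (ii) and (iii).
target : Letter → Forest → ℤ
target a F = maybe (targetNear a) (val a) (findBlock (val a) F)

targetNear-true : ∀ y c → ltL (lab c) y ≡ true → targetNear y c ≡ hi c + 1ℤ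
targetNear-true y c e rewrite e = refl

targetNear-false : ∀ y c → ltL (lab c) y ≡ false → targetNear y c ≡ lo c - 1ℤ
targetNear-false y c e rewrite e = refl

step≡joinAt-target : ∀ a n F → step a n F ≡ joinAt (target a F) a n F
step≡joinAt-target a n F with findBlock (val a) F
... | nothing = refl
... | just b with ltL (lab b) a
... | true = refl
... | false = refl

Sep⇒hi≢ : ∀ {c d} → Sep c d → ¬ (hi c ≡ hi d)
Sep⇒hi≢ {c} {d} (mkSep s) e = ZP.<⇒≱ (ZP.<-trans (i<i+1 (hi c)) s) (subst (lo d ≤_) (sym e) (lo≤hi d))

Sep⇒lo≢ : ∀ {c d} → Sep c d → ¬ (lo c ≡ lo d)
Sep⇒lo≢ {c} {d} s e = ZP.<⇒≢ (Sep⇒lo< {c} {d} s) e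

record ExtractSpec (f : Block → ℤ) (h : ℤ) (F : Forest) (m : Maybe Block) (F' : Forest) : Set where
  field
    ∈-rest⁻  : ∀ {c} → c ∈ F' → c ∈ F × ¬ (f c ≡ h)
    ∈-rest⁺ : ∀ {c} → c ∈ F → ¬ (f c ≡ h) → c ∈ F'
    extracted    : (m ≡ nothing × (∀ {c} → c ∈ F → ¬ (f c ≡ h)))
           ⊎ Σ Block (λ l → m ≡ just l × l ∈ F × f l ≡ h)
    rest-sorted   : AllPairs Sep F'
open ExtractSpec public

data ExtractShape (f : Block → ℤ) (h : ℤ) (F : Forest) : Maybe Block × Forest → Set where
  none : All (λ c → ¬ (f c ≡ h)) F → ExtractShape f h F (nothing , F)
  some : ∀ l xs ys → F ≡ xs ++ l ∷ ys → f l ≡ h → All (λ c → ¬ (f c ≡ h)) xs →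
         ExtractShape f h F (just l , xs ++ ys)

extractHi-shape : ∀ h F → ExtractShape hi h F (extractHi h F)
extractHi-shape h [] = none []
extractHi-shape h (b ∷ bs) with hi b Z.≟ h
... | yes p = some b [] bs refl p []
... | no np with extractHi h bs | extractHi-shape h bs
... | .(nothing , bs) | none al = none (np ∷ al)
... | .(just l , xs ++ ys) | some l xs ys e p al = some l (b ∷ xs) ys (cong (b ∷_) e) p (np ∷ al)

extractLo-shape : ∀ h F → ExtractShape lo h F (extractLo h F)
extractLo-shape h [] = none []
extractLo-shape h (b ∷ bs) with lo b Z.≟ h
... | yes p = some b [] bs refl p []
... | no np with extractLo h bs | extractLo-shape h bs
... | .(nothing , bs) | none al = none (np ∷ al)
... | .(just l , xs ++ ys) | some l xs ys e p al = some l (b ∷ xs) ys (cong (b ∷_) e) p (np ∷ al)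

shape⇒spec : ∀ {f h F r} → (∀ {c d} → Sep c d → ¬ (f c ≡ f d)) → AllPairs Sep F → ExtractShape f h F r →
             ExtractSpec f h F (proj₁ r) (proj₂ r)
shape⇒spec {f} {h} inj ap (none al) = record
  { ∈-rest⁻ = λ m → m , All.lookup al m ; ∈-rest⁺ = λ m _ → m ; extracted = inj₁ (refl , All.lookup al) ; rest-sorted = ap }
shape⇒spec {f} {h} {F} inj ap (some l xs ys refl p al) = record
  { ∈-rest⁻ = mem ; ∈-rest⁺ = λ m n → ∈-drop-mid xs ys m (λ { refl → n p }) ; extracted = inj₂ (l , refl , ∈-insert xs , p)
  ; rest-sorted = AllPairs-drop-mid xs ys ap }
  where
  mem : ∀ {c} → c ∈ xs ++ ys → c ∈ F × ¬ (f c ≡ h)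
  mem {c} m with ∈-++⁻ xs m
  ... | inj₁ mx = ∈-add-mid xs ys m , All.lookup al mx
  ... | inj₂ my = ∈-add-mid xs ys m , λ e → inj (All.lookup (AllPairs-mid xs ys ap) my) (trans p (sym e))

extractHi-spec : ∀ h F → AllPairs Sep F → ExtractSpec hi h F (proj₁ (extractHi h F)) (proj₂ (extractHi h F))
extractHi-spec h F ap = shape⇒spec (λ {c} {d} → Sep⇒hi≢ {c} {d}) ap (extractHi-shape h F)

extractLo-spec : ∀ h F → AllPairs Sep F → ExtractSpec lo h F (proj₁ (extractLo h F)) (proj₂ (extractLo h F))
extractLo-spec h F ap = shape⇒spec (λ {c} {d} → Sep⇒lo≢ {c} {d}) ap (extractLo-shape h F)

∈-insertBlock⁻ : ∀ {c} b F → c ∈ insertBlock b F → c ≡ b ⊎ c ∈ F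
∈-insertBlock⁻ b [] (here e) = inj₁ e
∈-insertBlock⁻ b (c ∷ cs) m with lo b Z.<? lo c
∈-insertBlock⁻ b (c ∷ cs) (here e) | yes _ = inj₁ e
∈-insertBlock⁻ b (c ∷ cs) (there m) | yes _ = inj₂ m
∈-insertBlock⁻ b (c ∷ cs) (here e) | no _ = inj₂ (here e)
∈-insertBlock⁻ b (c ∷ cs) (there m) | no _ with ∈-insertBlock⁻ b cs m
... | inj₁ e = inj₁ e
... | inj₂ m' = inj₂ (there m')

∈-insertBlock-new : ∀ b F → b ∈ insertBlock b F
∈-insertBlock-new b [] = here refl
∈-insertBlock-new b (c ∷ cs) with lo b Z.<? lo c
... | yes _ = here refl
... | no _ = there (∈-insertBlock-new b cs)

∈-insertBlock⁺ : ∀ {d} b F → d ∈ F → d ∈ insertBlock b F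
∈-insertBlock⁺ b (c ∷ cs) m with lo b Z.<? lo c
... | yes _ = there m
∈-insertBlock⁺ b (c ∷ cs) (here e) | no _ = here e
∈-insertBlock⁺ b (c ∷ cs) (there m) | no _ = there (∈-insertBlock⁺ b cs m)

Apart : Block → Block → Set
Apart b d = Sep b d ⊎ Sep d b

All-insertBlock : ∀ {P : Block → Set} b F → P b → All P F → All P (insertBlock b F)
All-insertBlock b [] pb [] = pb ∷ []
All-insertBlock b (c ∷ cs) pb (pc ∷ ps) with lo b Z.<? lo c
... | yes _ = pb ∷ pc ∷ ps
... | no _ = pc ∷ All-insertBlock b cs pb ps

lo<⇒Sep : ∀ {b c} → lo b < lo c → Apart b c → Sep b c
lo<⇒Sep _ (inj₁ s) = s
lo<⇒Sep {b} {c} lt (inj₂ s) = ⊥-elim (ZP.<-asym lt (Sep⇒lo< {c} {b} s))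

lo≮⇒Sep : ∀ {b c} → ¬ (lo b < lo c) → Apart b c → Sep c b
lo≮⇒Sep {b} {c} n (inj₁ s) = ⊥-elim (n (Sep⇒lo< {b} {c} s))
lo≮⇒Sep _ (inj₂ s) = s

AllPairs-insertBlock : ∀ b F → All (Apart b) F → AllPairs Sep F → AllPairs Sep (insertBlock b F)
AllPairs-insertBlock b [] _ _ = [] ∷ []
AllPairs-insertBlock b (c ∷ cs) (sc ∷ ss) (pc ∷ pcs) with lo b Z.<? lo c
... | yes lt = (lo<⇒Sep {b} {c} lt sc ∷ go cs ss pc) ∷ pc ∷ pcs
  where
  go : ∀ ds → All (Apart b) ds → All (Sep c) ds → All (Sep b) ds
  go [] _ _ = []
  go (d ∷ ds) (sd ∷ sds) (cd ∷ cds) = lo<⇒Sep {b} {d} (ZP.<-trans lt (Sep⇒lo< {c} {d} cd)) sd ∷ go ds sds cds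
... | no nlt = All-insertBlock {Sep c} b cs (lo≮⇒Sep {b} {c} nlt sc) pc ∷ AllPairs-insertBlock b cs ss pcs

leftNbr : ℤ → Forest → Maybe Block
leftNbr g F = proj₁ (extractHi (g - 1ℤ) F)
minusLeft : ℤ → Forest → Forest
minusLeft g F = proj₂ (extractHi (g - 1ℤ) F)
rightNbr : ℤ → Forest → Maybe Block
rightNbr g F = proj₁ (extractLo (g + 1ℤ) (minusLeft g F))
minusNbrs : ℤ → Forest → Forest
minusNbrs g F = proj₂ (extractLo (g + 1ℤ) (minusLeft g F))

joined : ℤ → Letter → ℕ → Forest → Block
joined g a n F = blk (maybe lo g (leftNbr g F)) (maybe tree leaf (leftNbr g F)) a n (maybe tree leaf (rightNbr g F))

LeftNbrView : ℤ → Forest → Set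
LeftNbrView g F = (leftNbr g F ≡ nothing × (∀ {c} → c ∈ F → ¬ (hi c ≡ g - 1ℤ)))
       ⊎ Σ Block (λ l → leftNbr g F ≡ just l × l ∈ F × hi l ≡ g - 1ℤ)

RightNbrView : ℤ → Forest → Set
RightNbrView g F = (rightNbr g F ≡ nothing × (∀ {c} → c ∈ F → ¬ (lo c ≡ g + 1ℤ)))
       ⊎ Σ Block (λ r → rightNbr g F ≡ just r × r ∈ F × lo r ≡ g + 1ℤ)

leftNbr-view : ∀ g F → AllPairs Sep F → LeftNbrView g F
leftNbr-view g F ap = extracted (extractHi-spec (g - 1ℤ) F ap)

lo≡+1⇒hi≢-1 : ∀ g c → lo c ≡ g + 1ℤ → ¬ (hi c ≡ g - 1ℤ)
lo≡+1⇒hi≢-1 g c e1 e2 = ZP.<⇒≱ (ZP.<-trans (i-1<i g) (i<i+1 g))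
  (subst₂ _≤_ e1 e2 (lo≤hi c))

rightNbr-view : ∀ g F → AllPairs Sep F → RightNbrView g F
rightNbr-view g F ap with extracted (extractLo-spec (g + 1ℤ) (minusLeft g F) (rest-sorted (extractHi-spec (g - 1ℤ) F ap)))
... | inj₁ (e , f) = inj₁ (e , λ {c} m eq → f (∈-rest⁺ (extractHi-spec (g - 1ℤ) F ap) m (lo≡+1⇒hi≢-1 g c eq)) eq)
... | inj₂ (r , e , m , eq) = inj₂ (r , e , proj₁ (∈-rest⁻ (extractHi-spec (g - 1ℤ) F ap) m) , eq)

leftNbr∈ : ∀ g F → AllPairs Sep F → ∀ {l} → leftNbr g F ≡ just l → l ∈ F
leftNbr∈ g F ap {l} e with leftNbr-view g F ap
... | inj₁ (e' , _) = ⊥-elim (just≢nothing (trans (sym e) e'))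
... | inj₂ (l' , e' , m , _) with trans (sym e) e'
... | refl = m

rightNbr∈ : ∀ g F → AllPairs Sep F → ∀ {l} → rightNbr g F ≡ just l → l ∈ F
rightNbr∈ g F ap {l} e with rightNbr-view g F ap
... | inj₁ (e' , _) = ⊥-elim (just≢nothing (trans (sym e) e'))
... | inj₂ (l' , e' , m , _) with trans (sym e) e'
... | refl = m

∈-minusNbrs⁻ : ∀ g F → AllPairs Sep F → ∀ {c} → c ∈ minusNbrs g F → c ∈ F × ¬ (hi c ≡ g - 1ℤ) × ¬ (lo c ≡ g + 1ℤ)
∈-minusNbrs⁻ g F ap m =
  let (m1 , n1) = ∈-rest⁻ (extractLo-spec (g + 1ℤ) (minusLeft g F) (rest-sorted (extractHi-spec (g - 1ℤ) F ap))) m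
      (m2 , n2) = ∈-rest⁻ (extractHi-spec (g - 1ℤ) F ap) m1
  in m2 , n2 , n1

∈-minusNbrs⁺ : ∀ g F → AllPairs Sep F → ∀ {c} → c ∈ F → ¬ (hi c ≡ g - 1ℤ) → ¬ (lo c ≡ g + 1ℤ) → c ∈ minusNbrs g F
∈-minusNbrs⁺ g F ap m n1 n2 =
  ∈-rest⁺ (extractLo-spec (g + 1ℤ) (minusLeft g F) (rest-sorted (extractHi-spec (g - 1ℤ) F ap))) (∈-rest⁺ (extractHi-spec (g - 1ℤ) F ap) m n1) n2

minusNbrs-sorted : ∀ g F → AllPairs Sep F → AllPairs Sep (minusNbrs g F)
minusNbrs-sorted g F ap = rest-sorted (extractLo-spec (g + 1ℤ) (minusLeft g F) (rest-sorted (extractHi-spec (g - 1ℤ) F ap)))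

blk-hi+1 : ∀ i l a n r → hi (blk i l a n r) + 1ℤ ≡ ((i + + size l) + 1ℤ) + + size r
blk-hi+1 i l a n r = begin
    hi (blk i l a n r) + 1ℤ                ≡⟨ -1+1 _ ⟩
    i + + (size l ℕ.+ suc (size r))        ≡⟨ cong (λ z → i + z) (ZP.pos-+ (size l) (suc (size r))) ⟩
    i + (+ size l + + suc (size r))        ≡⟨ cong (λ z → i + (+ size l + z)) (ZP.pos-+ 1 (size r)) ⟩
    i + (+ size l + (1ℤ + + size r))       ≡⟨ reassociate i (+ size l) (+ size r) ⟩
    ((i + + size l) + 1ℤ) + + size r       ∎
  where
  open ≡-Reasoning
  reassociate : ∀ x y z → x + (y + (1ℤ + z)) ≡ ((x + y) + 1ℤ) + z
  reassociate = solve-∀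

left-end : ∀ g F → LeftNbrView g F → maybe lo g (leftNbr g F) + + size (maybe tree leaf (leftNbr g F)) ≡ g
left-end g F (inj₁ (e , _)) rewrite e = ZP.+-identityʳ g
left-end g F (inj₂ (l , e , _ , h)) rewrite e = trans (sym (-1+1 _)) (trans (cong (_+ 1ℤ) h) (-1+1 g))

joined-hi+1 : ∀ g a n F → LeftNbrView g F → hi (joined g a n F) + 1ℤ ≡ (g + 1ℤ) + + size (maybe tree leaf (rightNbr g F))
joined-hi+1 g a n F v = trans (blk-hi+1 (maybe lo g (leftNbr g F)) (maybe tree leaf (leftNbr g F)) a n (maybe tree leaf (rightNbr g F))) (cong (λ z → (z + 1ℤ) + + size (maybe tree leaf (rightNbr g F))) (left-end g F v))

+1-injective : ∀ {i j} → i + 1ℤ ≡ j + 1ℤ → i ≡ j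
+1-injective {i} {j} e = trans (sym (+1-1 i)) (trans (cong (_- 1ℤ) e) (+1-1 j))

joined-hi-noRight : ∀ g a n F → LeftNbrView g F → rightNbr g F ≡ nothing → hi (joined g a n F) ≡ g
joined-hi-noRight g a n F v e = +1-injective (trans (joined-hi+1 g a n F v) (trans (cong (λ z → (g + 1ℤ) + + size (maybe tree leaf z)) e) (ZP.+-identityʳ _)))

joined-hi-right : ∀ g a n F → LeftNbrView g F → ∀ {r} → rightNbr g F ≡ just r → lo r ≡ g + 1ℤ → hi (joined g a n F) ≡ hi r
joined-hi-right g a n F v {r} e h = +1-injective (trans (joined-hi+1 g a n F v)
   (trans (cong (λ z → (g + 1ℤ) + + size (maybe tree leaf z)) e)
   (trans (cong (λ z → z + + size (tree r)) (sym h)) (sym (-1+1 _)))))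

joined-lo-noLeft : ∀ g a n F → leftNbr g F ≡ nothing → lo (joined g a n F) ≡ g
joined-lo-noLeft g a n F e rewrite e = refl

joined-lo-left : ∀ g a n F {l} → leftNbr g F ≡ just l → lo (joined g a n F) ≡ lo l
joined-lo-left g a n F e rewrite e = refl

joined-lo≤ : ∀ g a n F → LeftNbrView g F → lo (joined g a n F) ≤ g
joined-lo≤ g a n F (inj₁ (e , _)) = ZP.≤-reflexive (joined-lo-noLeft g a n F e)
joined-lo≤ g a n F (inj₂ (l , e , m , h)) rewrite joined-lo-left g a n F e =
  ZP.≤-trans (lo≤hi l) (ZP.≤-trans (ZP.≤-reflexive h) (ZP.<⇒≤ (i-1<i g)))

≤joined-hi : ∀ g a n F → LeftNbrView g F → RightNbrView g F → g ≤ hi (joined g a n F)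
≤joined-hi g a n F v (inj₁ (e , _)) = ZP.≤-reflexive (sym (joined-hi-noRight g a n F v e))
≤joined-hi g a n F v (inj₂ (r , e , m , h)) rewrite joined-hi-right g a n F v e h =
  ZP.≤-trans (ZP.<⇒≤ (i<i+1 g)) (ZP.≤-trans (ZP.≤-reflexive (sym h)) (lo≤hi r))

In-joined-centre : ∀ g a n F → LeftNbrView g F → RightNbrView g F → In g (joined g a n F)
In-joined-centre g a n F v w = mkIn (joined-lo≤ g a n F v) (≤joined-hi g a n F v w)

In-joined-left : ∀ g a n F → LeftNbrView g F → RightNbrView g F → ∀ {l i} → leftNbr g F ≡ just l → In i l → In i (joined g a n F)
In-joined-left g a n F v w {l} e (mkIn p q) with v
... | inj₁ (e' , _) = ⊥-elim (just≢nothing (trans (sym e) e'))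
... | inj₂ (l' , e' , m , h) with trans (sym e) e'
... | refl = mkIn (subst (_≤ _) (sym (joined-lo-left g a n F e)) p)
   (ZP.≤-trans q (ZP.≤-trans (ZP.≤-reflexive h) (ZP.≤-trans (ZP.<⇒≤ (i-1<i g)) (≤joined-hi g a n F v w))))

In-joined-right : ∀ g a n F → LeftNbrView g F → RightNbrView g F → ∀ {r i} → rightNbr g F ≡ just r → In i r → In i (joined g a n F)
In-joined-right g a n F v w {r} e (mkIn p q) with w
... | inj₁ (e' , _) = ⊥-elim (just≢nothing (trans (sym e) e'))
... | inj₂ (r' , e' , m , h) with trans (sym e) e'
... | refl = mkIn (ZP.≤-trans (joined-lo≤ g a n F v) (ZP.≤-trans (ZP.<⇒≤ (i<i+1 g)) (ZP.≤-trans (ZP.≤-reflexive (sym h)) p)))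
   (subst (_ ≤_) (sym (joined-hi-right g a n F v e h)) q)

In-joined⁻ : ∀ g a n F → LeftNbrView g F → RightNbrView g F → ∀ {i} → In i (joined g a n F) →
   Σ Block (λ l → leftNbr g F ≡ just l × l ∈ F × In i l) ⊎ (i ≡ g) ⊎ Σ Block (λ r → rightNbr g F ≡ just r × r ∈ F × In i r)
In-joined⁻ g a n F v w {i} (mkIn p q) with trichotomy i g
In-joined⁻ g a n F (inj₁ (e , _)) w {i} (mkIn p q) | inj₁ lt = ⊥-elim (ZP.<⇒≱ lt (subst (_≤ i) (joined-lo-noLeft g a n F e) p))
In-joined⁻ g a n F (inj₂ (l , e , m , h)) w {i} (mkIn p q) | inj₁ lt =
  inj₁ (l , e , m , mkIn (subst (_≤ i) (joined-lo-left g a n F e) p) (subst (i ≤_) (sym h) (<⇒≤-1 lt)))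
... | inj₂ (inj₁ eq) = inj₂ (inj₁ eq)
In-joined⁻ g a n F v (inj₁ (e , _)) {i} (mkIn p q) | inj₂ (inj₂ gt) = ⊥-elim (ZP.<⇒≱ gt (subst (i ≤_) (joined-hi-noRight g a n F v e) q))
In-joined⁻ g a n F v (inj₂ (r , e , m , h)) {i} (mkIn p q) | inj₂ (inj₂ gt) =
  inj₂ (inj₂ (r , e , m , mkIn (subst (_≤ i) (sym h) (<⇒+1≤ gt)) (subst (i ≤_) (joined-hi-right g a n F v e h) q)))

hi-injective : ∀ {F c d} → AllPairs Sep F → c ∈ F → d ∈ F → hi c ≡ hi d → c ≡ d
hi-injective {F} {c} {d} ap m n e with Sep-trichotomy ap m n
... | inj₁ x = x
... | inj₂ (inj₁ s) = ⊥-elim (Sep⇒hi≢ {c} {d} s e)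
... | inj₂ (inj₂ s) = ⊥-elim (Sep⇒hi≢ {d} {c} s (sym e))

lo-injective : ∀ {F c d} → AllPairs Sep F → c ∈ F → d ∈ F → lo c ≡ lo d → c ≡ d
lo-injective {F} {c} {d} ap m n e with Sep-trichotomy ap m n
... | inj₁ x = x
... | inj₂ (inj₁ s) = ⊥-elim (Sep⇒lo≢ {c} {d} s e)
... | inj₂ (inj₂ s) = ⊥-elim (Sep⇒lo≢ {d} {c} s (sym e))

Free-hi+1 : ∀ {F b} → AllPairs Sep F → b ∈ F → Free (hi b + 1ℤ) F
Free-hi+1 {F} {b} ap m s with InSupp⇒In s
... | c , mc , mkIn p q with Sep-trichotomy ap m mc
... | inj₁ refl = ZP.<⇒≱ (i<i+1 (hi b)) q
... | inj₂ (inj₁ (mkSep s')) = ZP.<⇒≱ s' p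
... | inj₂ (inj₂ (mkSep s')) = ZP.<-asym s' (ZP.≤-<-trans (lo≤hi b) (ZP.<-≤-trans (i<i+1 (hi b)) (ZP.≤-trans q (ZP.<⇒≤ (i<i+1 (hi c))))))

Free-lo-1 : ∀ {F b} → AllPairs Sep F → b ∈ F → Free (lo b - 1ℤ) F
Free-lo-1 {F} {b} ap m s with InSupp⇒In s
... | c , mc , mkIn p q with Sep-trichotomy ap m mc
... | inj₁ refl = ZP.<⇒≱ (i-1<i (lo b)) p
... | inj₂ (inj₁ (mkSep s')) = ZP.<-irrefl refl (ZP.≤-<-trans p (ZP.<-≤-trans (i-1<i (lo b)) (ZP.≤-trans (lo≤hi b) (ZP.<⇒≤ (ZP.<-trans (i<i+1 (hi b)) s')))))
... | inj₂ (inj₂ (mkSep s')) = ZP.<-irrefl refl (ZP.<-≤-trans (+1≤⇒< (<⇒≤-1 s')) q)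

module Join (g : ℤ) (a : Letter) (n : ℕ) (F : Forest) (ap : AllPairs Sep F) (fr : Free g F) where
  N = joined g a n F
  G = joinAt g a n F
  vL = leftNbr-view g F ap
  vR = rightNbr-view g F ap

  ∈-join⁻ : ∀ {c} → c ∈ G → c ≡ N ⊎ (c ∈ F × ¬ (hi c ≡ g - 1ℤ) × ¬ (lo c ≡ g + 1ℤ))
  ∈-join⁻ m with ∈-insertBlock⁻ N (minusNbrs g F) m
  ... | inj₁ e = inj₁ e
  ... | inj₂ m' = inj₂ (∈-minusNbrs⁻ g F ap m')

  ∈-join⁺ : ∀ {c} → c ∈ F → ¬ (hi c ≡ g - 1ℤ) → ¬ (lo c ≡ g + 1ℤ) → c ∈ G
  ∈-join⁺ m n1 n2 = ∈-insertBlock⁺ N (minusNbrs g F) (∈-minusNbrs⁺ g F ap m n1 n2)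

  new∈join : N ∈ G
  new∈join = ∈-insertBlock-new N (minusNbrs g F)

  ¬In-free : ∀ {c} → c ∈ F → ¬ In g c
  ¬In-free m i = fr (In⇒InSupp m i)

  new-apart : ∀ {d} → d ∈ minusNbrs g F → Apart N d
  new-apart {d} m with ∈-minusNbrs⁻ g F ap m
  ... | md , nh , nl with trichotomy (hi d) g
  new-apart {d} m | md , nh , nl | inj₁ hlt with vL
  ... | inj₁ (e , _) = inj₂ (mkSep (subst (_ <_) (sym (joined-lo-noLeft g a n F e))
          (subst (_ <_) (-1+1 g) (ZP.+-monoˡ-< 1ℤ (ZP.≤∧≢⇒< (<⇒≤-1 hlt) nh)))))
  ... | inj₂ (l , e , ml , h) with Sep-trichotomy ap md ml
  ...   | inj₁ refl = ⊥-elim (nh h)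
  ...   | inj₂ (inj₁ (mkSep s)) = inj₂ (mkSep (subst (_ <_) (sym (joined-lo-left g a n F e)) s))
  ...   | inj₂ (inj₂ (mkSep s)) = ⊥-elim (ZP.<⇒≱ (ZP.<-≤-trans (subst (_< lo d) (trans (cong (_+ 1ℤ) h) (-1+1 g)) s) (lo≤hi d)) (ZP.<⇒≤ hlt))
  new-apart {d} m | md , nh , nl | inj₂ (inj₁ eq) = ⊥-elim (¬In-free md (mkIn (subst (lo d ≤_) eq (lo≤hi d)) (ZP.≤-reflexive (sym eq))))
  new-apart {d} m | md , nh , nl | inj₂ (inj₂ hgt) with trichotomy (lo d) g
  ... | inj₁ llt = ⊥-elim (¬In-free md (mkIn (ZP.<⇒≤ llt) (ZP.<⇒≤ hgt)))
  ... | inj₂ (inj₁ eq) = ⊥-elim (¬In-free md (mkIn (ZP.≤-reflexive eq) (ZP.<⇒≤ hgt)))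
  ... | inj₂ (inj₂ lgt) with vR
  ...   | inj₁ (e , _) = inj₁ (mkSep (subst (λ z → z + 1ℤ < lo d) (sym (joined-hi-noRight g a n F vL e))
           (ZP.≤∧≢⇒< (<⇒+1≤ lgt) (λ eq → nl (sym eq)))))
  ...   | inj₂ (r , e , mr , h) with Sep-trichotomy ap md mr
  ...     | inj₁ refl = ⊥-elim (nl h)
  ...     | inj₂ (inj₂ (mkSep s)) = inj₁ (mkSep (subst (λ z → z + 1ℤ < lo d) (sym (joined-hi-right g a n F vL e h)) s))
  ...     | inj₂ (inj₁ (mkSep s)) = ⊥-elim (ZP.<-asym (+1≤⇒< (<+1⇒≤ (subst (_ <_) h s))) (ZP.<-≤-trans lgt (lo≤hi d)))

  join-sorted : AllPairs Sep G
  join-sorted = AllPairs-insertBlock N (minusNbrs g F) (All.tabulate new-apart) (minusNbrs-sorted g F ap)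

  join-labelIn : All LabelIn F → LabelIn N → All LabelIn G
  join-labelIn al ln = All-insertBlock N (minusNbrs g F) ln (All.tabulate (λ m → All.lookup al (proj₁ (∈-minusNbrs⁻ g F ap m))))

leftNbr-hi+1 : ∀ {F b} → AllPairs Sep F → b ∈ F → leftNbr (hi b + 1ℤ) F ≡ just b
leftNbr-hi+1 {F} {b} ap m with leftNbr-view (hi b + 1ℤ) F ap
... | inj₁ (e , f) = ⊥-elim (f m (sym (+1-1 (hi b))))
... | inj₂ (l , e , ml , h) = trans e (cong just (hi-injective ap ml m (trans h (+1-1 (hi b)))))

rightNbr-lo-1 : ∀ {F b} → AllPairs Sep F → b ∈ F → rightNbr (lo b - 1ℤ) F ≡ just b
rightNbr-lo-1 {F} {b} ap m with rightNbr-view (lo b - 1ℤ) F ap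
... | inj₁ (e , f) = ⊥-elim (f m (sym (-1+1 (lo b))))
... | inj₂ (l , e , ml , h) = trans e (cong just (lo-injective ap ml m (trans h (-1+1 (lo b)))))

target-free : ∀ a F → AllPairs Sep F → Free (target a F) F
target-free a F ap with findBlock-view (val a) F
... | inj₂ e rewrite e = findBlock-nothing (val a) F e
... | inj₁ (b , e) rewrite e with findBlock-just (val a) F e
... | mb , _ with ltL (lab b) a
... | true = Free-hi+1 ap mb
... | false = Free-lo-1 ap mb

target-labelIn : ∀ a n F → AllPairs Sep F → LabelIn (joined (target a F) a n F)
target-labelIn a n F ap with findBlock-view (val a) F
... | inj₂ e rewrite e = In-joined-centre (val a) a n F (leftNbr-view (val a) F ap) (rightNbr-view (val a) F ap)
... | inj₁ (b , e) rewrite e with findBlock-just (val a) F e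
... | mb , ib with ltL (lab b) a
... | true = In-joined-left (hi b + 1ℤ) a n F (leftNbr-view (hi b + 1ℤ) F ap) (rightNbr-view (hi b + 1ℤ) F ap) (leftNbr-hi+1 ap mb) ib
... | false = In-joined-right (lo b - 1ℤ) a n F (leftNbr-view (lo b - 1ℤ) F ap) (rightNbr-view (lo b - 1ℤ) F ap) (rightNbr-lo-1 ap mb) ib

module Step (a : Letter) (n : ℕ) (F : Forest) (ap : AllPairs Sep F) where
  g = target a F
  fr = target-free a F ap
  open Join g a n F ap fr public

  step≡join : step a n F ≡ G
  step≡join = step≡joinAt-target a n F

  ∈-step-or-nbr : ∀ {c} → c ∈ F → c ∈ G ⊎ (leftNbr g F ≡ just c) ⊎ (rightNbr g F ≡ just c)
  ∈-step-or-nbr {c} m with hi c Z.≟ (g - 1ℤ) | lo c Z.≟ (g + 1ℤ)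
  ... | no n1 | no n2 = inj₁ (∈-join⁺ m n1 n2)
  ... | yes e | _ with vL
  ...   | inj₁ (_ , f) = ⊥-elim (f m e)
  ...   | inj₂ (l , el , ml , h) = inj₂ (inj₁ (trans el (cong just (hi-injective ap ml m (trans h (sym e))))))
  ∈-step-or-nbr {c} m | no _ | yes e with vR
  ...   | inj₁ (_ , f) = ⊥-elim (f m e)
  ...   | inj₂ (r , er , mr , h) = inj₂ (inj₂ (trans er (cong just (lo-injective ap mr m (trans h (sym e))))))

step-wellFormed : ∀ a n F → WellFormed F → WellFormed (step a n F)
step-wellFormed a n F (ap , al) rewrite Step.step≡join a n F ap = Step.join-sorted a n F ap , Step.join-labelIn a n F ap al (target-labelIn a n F ap)

Node = ℕ × Letter

nodesT : Tree → List Node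
nodesT leaf = []
nodesT (node l a q r) = nodesT l ++ (q , a) ∷ nodesT r

nodesF : Forest → List Node
nodesF [] = []
nodesF (b ∷ bs) = nodesT (tree b) ++ nodesF bs

∈-nodesF⁻ : ∀ {x} F → x ∈ nodesF F → Σ Block (λ c → c ∈ F × x ∈ nodesT (tree c))
∈-nodesF⁻ (b ∷ bs) m with ∈-++⁻ (nodesT (tree b)) m
... | inj₁ p = b , here refl , p
... | inj₂ p with ∈-nodesF⁻ bs p
... | c , mc , pc = c , there mc , pc

∈-nodesF⁺ : ∀ {x c} F → c ∈ F → x ∈ nodesT (tree c) → x ∈ nodesF F
∈-nodesF⁺ (b ∷ bs) (here refl) p = ∈-++⁺ˡ p
∈-nodesF⁺ (b ∷ bs) (there m) p = ∈-++⁺ʳ (nodesT (tree b)) (∈-nodesF⁺ bs m p)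

qlabels≡nodes : ∀ t → qlabels t ≡ map proj₁ (nodesT t)
qlabels≡nodes leaf = refl
qlabels≡nodes (node l a q r) rewrite map-++ proj₁ (nodesT l) ((q , a) ∷ nodesT r) | qlabels≡nodes l | qlabels≡nodes r = refl

qlabelsF≡nodes : ∀ F → qlabelsF F ≡ map proj₁ (nodesF F)
qlabelsF≡nodes [] = refl
qlabelsF≡nodes (b ∷ bs) rewrite map-++ proj₁ (nodesT (tree b)) (nodesF bs) | qlabelsF≡nodes bs | qlabels≡nodes (tree b) = refl

maybeT : Maybe Block → Tree
maybeT = maybe tree leaf

module StepNodes (a : Letter) (n : ℕ) (F : Forest) (ap : AllPairs Sep F) where
  open Step a n F ap

  ∈-nodes-maybeT : ∀ {x} m → (∀ {c} → m ≡ just c → c ∈ F) → x ∈ nodesT (maybeT m) → x ∈ nodesF F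
  ∈-nodes-maybeT nothing f ()
  ∈-nodes-maybeT (just c) f p = ∈-nodesF⁺ F (f refl) p

  ∈-nodes-step⁻ : ∀ {x} → x ∈ nodesF (step a n F) → x ∈ nodesF F ⊎ x ≡ (n , a)
  ∈-nodes-step⁻ {x} m rewrite step≡join with ∈-nodesF⁻ G m
  ... | c , mc , p with ∈-join⁻ mc
  ... | inj₂ (mF , _) = inj₁ (∈-nodesF⁺ F mF p)
  ... | inj₁ refl with ∈-++⁻ (nodesT (maybeT (leftNbr g F))) p
  ...   | inj₁ p' = inj₁ (∈-nodes-maybeT (leftNbr g F) (leftNbr∈ g F ap) p')
  ...   | inj₂ (here e) = inj₂ e
  ...   | inj₂ (there p') = inj₁ (∈-nodes-maybeT (rightNbr g F) (rightNbr∈ g F ap) p')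

  new∈nodes-step : (n , a) ∈ nodesF (step a n F)
  new∈nodes-step rewrite step≡join = ∈-nodesF⁺ G new∈join (∈-++⁺ʳ (nodesT (maybeT (leftNbr g F))) (here refl))

  ∈-nodes-step⁺ : ∀ {x} → x ∈ nodesF F → x ∈ nodesF (step a n F)
  ∈-nodes-step⁺ {x} m rewrite step≡join with ∈-nodesF⁻ F m
  ... | c , mc , p with ∈-step-or-nbr mc
  ... | inj₁ mg = ∈-nodesF⁺ G mg p
  ... | inj₂ (inj₁ e) = ∈-nodesF⁺ G new∈join (∈-++⁺ˡ (subst (λ z → x ∈ nodesT (maybeT z)) (sym e) p))
  ... | inj₂ (inj₂ e) = ∈-nodesF⁺ G new∈join (∈-++⁺ʳ (nodesT (maybeT (leftNbr g F))) (there (subst (λ z → x ∈ nodesT (maybeT z)) (sym e) p)))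

  Desc-maybeT : ∀ {x y} m → (∀ {c} → m ≡ just c → c ∈ F) → DescT x y (maybeT m) → DescF x y F
  Desc-maybeT nothing f ()
  Desc-maybeT (just c) f d = lose (f refl) d

  Desc-step⁻ : ∀ {x y} → DescF x y (step a n F) →
    DescF x y F ⊎ (x ≡ n × y ∈ qlabels (maybeT (leftNbr g F)) ++ qlabels (maybeT (rightNbr g F)))
  Desc-step⁻ {x} {y} d rewrite step≡join with find d
  ... | c , mc , dc with ∈-join⁻ mc
  ... | inj₂ (mF , _) = inj₁ (lose mF dc)
  ... | inj₁ refl with dc
  ...   | here e p = inj₂ (sym e , p)
  ...   | inl d' = inj₁ (Desc-maybeT (leftNbr g F) (leftNbr∈ g F ap) d')
  ...   | inr d' = inj₁ (Desc-maybeT (rightNbr g F) (rightNbr∈ g F ap) d')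

  Desc-step⁺ : ∀ {x y} → DescF x y F → DescF x y (step a n F)
  Desc-step⁺ {x} {y} d rewrite step≡join with find d
  ... | c , mc , dc with ∈-step-or-nbr mc
  ... | inj₁ mg = lose mg dc
  ... | inj₂ (inj₁ e) = lose new∈join (inl (subst (λ z → DescT x y (maybeT z)) (sym e) dc))
  ... | inj₂ (inj₂ e) = lose new∈join (inr (subst (λ z → DescT x y (maybeT z)) (sym e) dc))

LabelsBelow : ℕ → Forest → Set
LabelsBelow n F = ∀ {q p} → (q , p) ∈ nodesF F → q ℕ.< n

∈-qlabelsF⇒node : ∀ {q} F → q ∈ qlabelsF F → Σ Letter (λ p → (q , p) ∈ nodesF F)
∈-qlabelsF⇒node {q} F m with ∈-map⁻ proj₁ (subst (q ∈_) (qlabelsF≡nodes F) m)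
... | (q' , p) , mm , refl = p , mm

∈-qlabels⇒node : ∀ {q} t → q ∈ qlabels t → Σ Letter (λ p → (q , p) ∈ nodesT t)
∈-qlabels⇒node {q} t m with ∈-map⁻ proj₁ (subst (q ∈_) (qlabels≡nodes t) m)
... | (q' , p) , mm , refl = p , mm

node⇒∈-qlabelsF : ∀ {q p} F → (q , p) ∈ nodesF F → q ∈ qlabelsF F
node⇒∈-qlabelsF {q} F m = subst (q ∈_) (sym (qlabelsF≡nodes F)) (∈-map⁺ proj₁ m)

DescT⇒∈ : ∀ {x y t} → DescT x y t → x ∈ qlabels t
DescT⇒∈ {t = node l a q r} (here e _) rewrite e = ∈-++⁺ʳ (qlabels l) (here refl)
DescT⇒∈ {t = node l a q r} (inl d) = ∈-++⁺ˡ (DescT⇒∈ d)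
DescT⇒∈ {t = node l a q r} (inr d) = ∈-++⁺ʳ (qlabels l) (there (DescT⇒∈ d))

DescF⇒∈ : ∀ {x y F} → DescF x y F → x ∈ qlabelsF F
DescF⇒∈ {x} {y} {F} d with find d
... | c , mc , dc with ∈-qlabels⇒node (tree c) (DescT⇒∈ dc)
... | p , m = node⇒∈-qlabelsF F (∈-nodesF⁺ F mc m)

qlabelsF-below : ∀ {x} G k → LabelsBelow k G → x ∈ qlabelsF G → x ℕ.< k
qlabelsF-below G k q mx with ∈-qlabelsF⇒node G mx
... | p , mn = q mn

step-labelsBelow : ∀ a n F → AllPairs Sep F → LabelsBelow n F → LabelsBelow (suc n) (step a n F)
step-labelsBelow a n F ap qb m with StepNodes.∈-nodes-step⁻ a n F ap m
... | inj₁ m' = NP.m<n⇒m<1+n (qb m')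
... | inj₂ refl = NP.n<1+n n

nth : ∀ {A : Set} → List A → ℕ → Maybe A
nth [] _ = nothing
nth (x ∷ xs) zero = just x
nth (x ∷ xs) (suc i) = nth xs i

insGo-++ : ∀ n F xs ys → insGo n F (xs ++ ys) ≡ insGo (n ℕ.+ length xs) (insGo n F xs) ys
insGo-++ n F [] ys = cong (λ m → insGo m F ys) (sym (NP.+-identityʳ n))
insGo-++ n F (x ∷ xs) ys = trans (insGo-++ (suc n) (step x n F) xs ys)
  (cong (λ m → insGo m (insGo (suc n) (step x n F) xs) ys) (sym (NP.+-suc n (length xs))))

insGo-wellFormed : ∀ n F xs → WellFormed F → WellFormed (insGo n F xs)
insGo-wellFormed n F [] i = i
insGo-wellFormed n F (x ∷ xs) i = insGo-wellFormed (suc n) (step x n F) xs (step-wellFormed x n F i)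

insGo-labelsBelow : ∀ n F xs → WellFormed F → LabelsBelow n F → LabelsBelow (n ℕ.+ length xs) (insGo n F xs)
insGo-labelsBelow n F [] i qb {q} m = subst (q ℕ.<_) (sym (NP.+-identityʳ n)) (qb m)
insGo-labelsBelow n F (x ∷ xs) i qb {q} m = subst (q ℕ.<_) (sym (NP.+-suc n (length xs)))
  (insGo-labelsBelow (suc n) (step x n F) xs (step-wellFormed x n F i) (step-labelsBelow x n F (proj₁ i) qb) m)

-- Letters are numbered from 0 in the list but their Q-labels start at n.
LetterAt : ℕ → List Letter → ℕ → Letter → Set
LetterAt n xs q p = Σ ℕ (λ i → q ≡ n ℕ.+ i × nth xs i ≡ just p)

∈-nodes-insGo⁻ : ∀ n F xs → WellFormed F → ∀ {q p} → (q , p) ∈ nodesF (insGo n F xs) → (q , p) ∈ nodesF F ⊎ LetterAt n xs q p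
∈-nodes-insGo⁻ n F [] i m = inj₁ m
∈-nodes-insGo⁻ n F (x ∷ xs) i m with ∈-nodes-insGo⁻ (suc n) (step x n F) xs (step-wellFormed x n F i) m
... | inj₂ (j , e , l) = inj₂ (suc j , trans e (sym (NP.+-suc n j)) , l)
... | inj₁ m' with StepNodes.∈-nodes-step⁻ x n F (proj₁ i) m'
... | inj₁ m'' = inj₁ m''
... | inj₂ refl = inj₂ (0 , sym (NP.+-identityʳ n) , refl)

∈-nodes-insGo⁺ : ∀ n F xs → WellFormed F → ∀ {q p} → (q , p) ∈ nodesF F ⊎ LetterAt n xs q p → (q , p) ∈ nodesF (insGo n F xs)
∈-nodes-insGo⁺ n F [] i (inj₁ m) = m
∈-nodes-insGo⁺ n F [] i (inj₂ (j , e , ()))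
∈-nodes-insGo⁺ n F (x ∷ xs) i (inj₁ m) =
  ∈-nodes-insGo⁺ (suc n) (step x n F) xs (step-wellFormed x n F i) (inj₁ (StepNodes.∈-nodes-step⁺ x n F (proj₁ i) m))
∈-nodes-insGo⁺ n F (x ∷ xs) i (inj₂ (zero , e , refl)) rewrite e | NP.+-identityʳ n =
  ∈-nodes-insGo⁺ (suc n) (step x n F) xs (step-wellFormed x n F i) (inj₁ (StepNodes.new∈nodes-step x n F (proj₁ i)))
∈-nodes-insGo⁺ n F (x ∷ xs) i (inj₂ (suc j , e , l)) =
  ∈-nodes-insGo⁺ (suc n) (step x n F) xs (step-wellFormed x n F i) (inj₂ (j , trans e (NP.+-suc n j) , l))

[]-wellFormed : WellFormed []
[]-wellFormed = [] , []

ins-wellFormed : ∀ W → WellFormed (ins W)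
ins-wellFormed W = insGo-wellFormed 1 [] W []-wellFormed

[]-labelsBelow : LabelsBelow 1 []
[]-labelsBelow ()

ins-labelsBelow : ∀ W → LabelsBelow (suc (length W)) (ins W)
ins-labelsBelow W = insGo-labelsBelow 1 [] W []-wellFormed []-labelsBelow

∈-nodes-ins⁻ : ∀ W {q p} → (q , p) ∈ nodesF (ins W) → LetterAt 1 W q p
∈-nodes-ins⁻ W m with ∈-nodes-insGo⁻ 1 [] W []-wellFormed m
... | inj₁ ()
... | inj₂ r = r

∈-nodes-ins⁺ : ∀ W {q p} → LetterAt 1 W q p → (q , p) ∈ nodesF (ins W)
∈-nodes-ins⁺ W r = ∈-nodes-insGo⁺ 1 [] W []-wellFormed (inj₂ r)

Desc-insGo⁺ : ∀ n F xs → WellFormed F → ∀ {x y} → DescF x y F → DescF x y (insGo n F xs)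
Desc-insGo⁺ n F [] i d = d
Desc-insGo⁺ n F (z ∷ xs) i d = Desc-insGo⁺ (suc n) (step z n F) xs (step-wellFormed z n F i) (StepNodes.Desc-step⁺ z n F (proj₁ i) d)

Desc-insGo⁻ : ∀ n F xs → WellFormed F → ∀ {x y} → x ℕ.< n → DescF x y (insGo n F xs) → DescF x y F
Desc-insGo⁻ n F [] i lt d = d
Desc-insGo⁻ n F (z ∷ xs) i {x} lt d with StepNodes.Desc-step⁻ z n F (proj₁ i)
   (Desc-insGo⁻ (suc n) (step z n F) xs (step-wellFormed z n F i) (NP.m<n⇒m<1+n lt) d)
... | inj₁ d' = d'
... | inj₂ (e , _) = ⊥-elim (NP.<-irrefl e lt)

-- Independence of insertions on opposite sides of a free cell

data Side : Set where
  before after : Side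

SideOf : ℤ → Side → ℤ → Set
SideOf f before i = i < f
SideOf f after i = f < i

BlockOnSide : ℤ → Side → Block → Set
BlockOnSide f s B = ∀ {i} → In i B → SideOf f s i

SideOf-unique : ∀ {f s s' i} → SideOf f s i → SideOf f s' i → s ≡ s'
SideOf-unique {s = before} {before} p q = refl
SideOf-unique {s = before} {after} p q = ⊥-elim (ZP.<-asym p q)
SideOf-unique {s = after} {before} p q = ⊥-elim (ZP.<-asym p q)
SideOf-unique {s = after} {after} p q = refl

lo-1≤targetNear : ∀ y c → lo c - 1ℤ ≤ targetNear y c
lo-1≤targetNear y c with ltL (lab c) y
... | true = ZP.≤-trans (ZP.<⇒≤ (i-1<i (lo c))) (ZP.≤-trans (lo≤hi c) (ZP.<⇒≤ (i<i+1 (hi c))))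
... | false = ZP.≤-refl

targetNear≤hi+1 : ∀ y c → targetNear y c ≤ hi c + 1ℤ
targetNear≤hi+1 y c with ltL (lab c) y
... | true = ZP.≤-refl
... | false = ZP.≤-trans (ZP.<⇒≤ (i-1<i (lo c))) (ZP.≤-trans (lo≤hi c) (ZP.<⇒≤ (i<i+1 (hi c))))

module Sides (F : Forest) (ap : AllPairs Sep F) (f : ℤ) (ff : Free f F) where

  block-side : ∀ {c} → c ∈ F → Σ Side (λ s → BlockOnSide f s c)
  block-side {c} m with trichotomy f (lo c)
  ... | inj₁ lt = after , λ (mkIn p q) → ZP.<-≤-trans lt p
  ... | inj₂ (inj₁ e) = ⊥-elim (ff (In⇒InSupp m (mkIn (ZP.≤-reflexive (sym e)) (subst (_≤ hi c) (sym e) (lo≤hi c)))))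
  ... | inj₂ (inj₂ gt) with trichotomy (hi c) f
  ...   | inj₁ lt = before , λ (mkIn p q) → ZP.≤-<-trans q lt
  ...   | inj₂ (inj₁ e) = ⊥-elim (ff (In⇒InSupp m (mkIn (ZP.<⇒≤ gt) (ZP.≤-reflexive (sym e)))))
  ...   | inj₂ (inj₂ gt') = ⊥-elim (ff (In⇒InSupp m (mkIn (ZP.<⇒≤ gt) (ZP.<⇒≤ gt'))))

  onSide-hi : ∀ {s B} → BlockOnSide f s B → SideOf f s (hi B)
  onSide-hi {B = B} o = o (mkIn (lo≤hi B) ZP.≤-refl)

  onSide-lo : ∀ {s B} → BlockOnSide f s B → SideOf f s (lo B)
  onSide-lo {B = B} o = o (mkIn ZP.≤-refl (lo≤hi B))

  side-leftAdj : ∀ {s s' B g} → BlockOnSide f s B → hi B ≡ g - 1ℤ → SideOf f s' g → s ≡ s'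
  side-leftAdj {before} {before} o e p = refl
  side-leftAdj {after} {after} o e p = refl
  side-leftAdj {before} {after} {B} {g} o e p =
    ⊥-elim (ZP.<⇒≱ (subst (_< f) e (onSide-hi {before} {B} o)) (<⇒≤-1 p))
  side-leftAdj {after} {before} {B} {g} o e p =
    ⊥-elim (ZP.<-asym p (ZP.<-trans (subst (f <_) e (onSide-hi {after} {B} o)) (i-1<i g)))

  side-rightAdj : ∀ {s s' B g} → BlockOnSide f s B → lo B ≡ g + 1ℤ → SideOf f s' g → s ≡ s'
  side-rightAdj {before} {before} o e p = refl
  side-rightAdj {after} {after} o e p = refl
  side-rightAdj {before} {after} {B} {g} o e p =
    ⊥-elim (ZP.<-asym p (ZP.<-trans (i<i+1 g) (subst (_< f) e (onSide-lo {before} {B} o))))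
  side-rightAdj {after} {before} {B} {g} o e p =
    ⊥-elim (ZP.<⇒≱ (subst (f <_) e (onSide-lo {after} {B} o)) (<⇒+1≤ p))

  side-targetNear : ∀ {s s' c y} → BlockOnSide f s c → SideOf f s' (targetNear y c) → s ≡ s'
  side-targetNear {before} {before} o p = refl
  side-targetNear {after} {after} o p = refl
  side-targetNear {before} {after} {c} {y} o p = ⊥-elim (ZP.<⇒≱ (ZP.<-≤-trans p (targetNear≤hi+1 y c)) (<⇒+1≤ (onSide-hi {before} {c} o)))
  side-targetNear {after} {before} {c} {y} o p = ⊥-elim (ZP.<⇒≱ (ZP.≤-<-trans (lo-1≤targetNear y c) p) (<⇒≤-1 (onSide-lo {after} {c} o)))

  joined-side : ∀ {s} g x m → Free g F → SideOf f s g → BlockOnSide f s (joined g x m F)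
  joined-side {s} g x m fg p {i} iN with In-joined⁻ g x m F (leftNbr-view g F ap) (rightNbr-view g F ap) iN
  ... | inj₂ (inj₁ refl) = p
  ... | inj₁ (l , e , ml , il) with block-side ml
  ...   | s₁ , o with leftNbr-view g F ap
  ...     | inj₁ (e' , _) = ⊥-elim (just≢nothing (trans (sym e) e'))
  ...     | inj₂ (l' , e' , _ , h) with trans (sym e) e'
  ...       | refl = subst (λ z → SideOf f z i) (side-leftAdj {s₁} {s} {l} o h p) (o il)
  joined-side {s} g x m fg p {i} iN | inj₂ (inj₂ (r , e , mr , ir)) with block-side mr
  ...   | s₁ , o with rightNbr-view g F ap
  ...     | inj₁ (e' , _) = ⊥-elim (just≢nothing (trans (sym e) e'))
  ...     | inj₂ (r' , e' , _ , h) with trans (sym e) e'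
  ...       | refl = subst (λ z → SideOf f z i) (side-rightAdj {s₁} {s} {r} o h p) (o ir)

leftNbr-cong : ∀ g G F → AllPairs Sep G → AllPairs Sep F →
  (∀ {c} → c ∈ G → hi c ≡ g - 1ℤ → c ∈ F) → (∀ {c} → c ∈ F → hi c ≡ g - 1ℤ → c ∈ G) → leftNbr g G ≡ leftNbr g F
leftNbr-cong g G F apG apF h₁ h₂ with leftNbr-view g G apG | leftNbr-view g F apF
... | inj₁ (e , _) | inj₁ (e' , _) = trans e (sym e')
... | inj₁ (e , f) | inj₂ (l , e' , ml , h) = ⊥-elim (f (h₂ ml h) h)
... | inj₂ (l , e , ml , h) | inj₁ (e' , f) = ⊥-elim (f (h₁ ml h) h)
... | inj₂ (l , e , ml , h) | inj₂ (l' , e' , ml' , h') =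
  trans e (trans (cong just (hi-injective apF (h₁ ml h) ml' (trans h (sym h')))) (sym e'))

rightNbr-cong : ∀ g G F → AllPairs Sep G → AllPairs Sep F →
  (∀ {c} → c ∈ G → lo c ≡ g + 1ℤ → c ∈ F) → (∀ {c} → c ∈ F → lo c ≡ g + 1ℤ → c ∈ G) → rightNbr g G ≡ rightNbr g F
rightNbr-cong g G F apG apF h₁ h₂ with rightNbr-view g G apG | rightNbr-view g F apF
... | inj₁ (e , _) | inj₁ (e' , _) = trans e (sym e')
... | inj₁ (e , f) | inj₂ (l , e' , ml , h) = ⊥-elim (f (h₂ ml h) h)
... | inj₂ (l , e , ml , h) | inj₁ (e' , f) = ⊥-elim (f (h₁ ml h) h)
... | inj₂ (l , e , ml , h) | inj₂ (l' , e' , ml' , h') =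
  trans e (trans (cong just (lo-injective apF (h₁ ml h) ml' (trans h (sym h')))) (sym e'))

target-just : ∀ y F {c} → findBlock (val y) F ≡ just c → target y F ≡ targetNear y c
target-just y F e = cong (maybe (targetNear y) (val y)) e

target-nothing : ∀ y F → findBlock (val y) F ≡ nothing → target y F ≡ val y
target-nothing y F e = cong (maybe (targetNear y) (val y)) e

record SeparatingCell (F : Forest) (a b : Letter) : Set where
  constructor sepCell
  field
    cell         : ℤ
    cell-free    : Free cell F
    side-a       : Side
    side-b       : Side
    a-side       : SideOf cell side-a (target a F)
    b-side       : SideOf cell side-b (target b F)
    sides-differ : ¬ (side-a ≡ side-b)

-- If the targets of x and y lie on opposite sides of the free cell f,
-- inserting x changes neither the target of y nor its neighbouring blocks.
module Independent (F : Forest) (ap : AllPairs Sep F) (f : ℤ) (ff : Free f F)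
             (x : Letter) (m : ℕ) (y : Letter) (s s' : Side)
             (px : SideOf f s (target x F)) (py : SideOf f s' (target y F)) (ne : ¬ (s ≡ s')) where
  open Sides F ap f ff
  open Step x m F ap
  gy = target y F
  frY = target-free y F ap
  new-side : BlockOnSide f s N
  new-side = joined-side g x m fr px

  survives : ∀ {c s₁} → c ∈ F → BlockOnSide f s₁ c → s₁ ≡ s' → c ∈ G
  survives {c} {s₁} mc o e = ∈-join⁺ mc (λ h → ne (trans (sym (side-leftAdj {s₁} {s} {c} o h px)) e))
                                 (λ h → ne (trans (sym (side-rightAdj {s₁} {s} {c} o h px)) e))

  target-preserved : target y (step x m F) ≡ gy
  target-preserved rewrite step≡join with findBlock-view (val y) F
  ... | inj₂ e with findBlock-view (val y) G
  ...   | inj₂ e' = trans (target-nothing y G e') (sym (target-nothing y F e))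
  ...   | inj₁ (c , e') with findBlock-just (val y) G e'
  ...     | mc , ic with ∈-join⁻ mc
  ...       | inj₁ refl = ⊥-elim (ne (SideOf-unique (new-side ic) (subst (SideOf f s') (target-nothing y F e) py)))
  ...       | inj₂ (mF , _) = ⊥-elim (findBlock-nothing (val y) F e (In⇒InSupp mF ic))
  target-preserved | inj₁ (c , e) with findBlock-just (val y) F e
  ... | mc , ic with block-side mc
  ... | s₁ , o = trans (target-just y G (findBlock-complete join-sorted (survives mc o (side-targetNear {s₁} {s'} {c} {y} o (subst (SideOf f s') (target-just y F e) py))) ic))
                       (sym (target-just y F e))

  fromF : ∀ {c i} → c ∈ G → In i c → SideOf f s' i → c ∈ F
  fromF mc ic p with ∈-join⁻ mc
  ... | inj₁ refl = ⊥-elim (ne (SideOf-unique (new-side ic) p))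
  ... | inj₂ (mF , _) = mF

  leftNbr-preserved : leftNbr gy G ≡ leftNbr gy F
  leftNbr-preserved = leftNbr-cong gy G F join-sorted ap
    (λ {c} mc h → fromF mc (mkIn (subst (lo c ≤_) h (lo≤hi c)) (ZP.≤-reflexive (sym h))) (adjPS c mc h))
    (λ {c} mc h → let (s₁ , o) = block-side mc in survives mc o (side-leftAdj {s₁} {s'} {c} o h py))
    where
    adjPS : ∀ c → c ∈ G → hi c ≡ gy - 1ℤ → SideOf f s' (gy - 1ℤ)
    adjPS c mc h with ∈-join⁻ mc
    ... | inj₁ refl = ⊥-elim (ne (side-leftAdj {s} {s'} {N} new-side h py))
    ... | inj₂ (mF , _) with block-side mF
    ...   | s₁ , o = subst (λ z → SideOf f z (gy - 1ℤ)) (side-leftAdj {s₁} {s'} {c} o h py) (o (mkIn (subst (lo c ≤_) h (lo≤hi c)) (ZP.≤-reflexive (sym h))))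

  rightNbr-preserved : rightNbr gy G ≡ rightNbr gy F
  rightNbr-preserved = rightNbr-cong gy G F join-sorted ap
    (λ {c} mc h → fromF mc (mkIn (ZP.≤-reflexive h) (subst (_≤ hi c) h (lo≤hi c))) (adjPS c mc h))
    (λ {c} mc h → let (s₁ , o) = block-side mc in survives mc o (side-rightAdj {s₁} {s'} {c} o h py))
    where
    adjPS : ∀ c → c ∈ G → lo c ≡ gy + 1ℤ → SideOf f s' (gy + 1ℤ)
    adjPS c mc h with ∈-join⁻ mc
    ... | inj₁ refl = ⊥-elim (ne (side-rightAdj {s} {s'} {N} new-side h py))
    ... | inj₂ (mF , _) with block-side mF
    ...   | s₁ , o = subst (λ z → SideOf f z (gy + 1ℤ)) (side-rightAdj {s₁} {s'} {c} o h py) (o (mkIn (ZP.≤-reflexive h) (subst (_≤ hi c) h (lo≤hi c))))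

  other-notLeftAdj : ∀ k → ¬ (hi (joined gy y k F) ≡ g - 1ℤ)
  other-notLeftAdj k h = ne (sym (side-leftAdj {s'} {s} {joined gy y k F} (joined-side gy y k frY py) h px))

  other-notRightAdj : ∀ k → ¬ (lo (joined gy y k F) ≡ g + 1ℤ)
  other-notRightAdj k h = ne (sym (side-rightAdj {s'} {s} {joined gy y k F} (joined-side gy y k frY py) h px))

swapN-other : ∀ k m q → ¬ (q ≡ k) → ¬ (q ≡ m) → swapN k m q ≡ q
swapN-other k m q n1 n2 with q ℕ.≟ k
... | yes e = ⊥-elim (n1 e)
... | no _ with q ℕ.≟ m
... | yes e = ⊥-elim (n2 e)
... | no _ = refl

swapN-first : ∀ k m → swapN k m k ≡ m
swapN-first k m with k ℕ.≟ k
... | yes _ = refl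
... | no ne = ⊥-elim (ne refl)

swapN-second : ∀ k m → ¬ (m ≡ k) → swapN k m m ≡ k
swapN-second k m ne with m ℕ.≟ k
... | yes e = ⊥-elim (ne e)
... | no _ with m ℕ.≟ m
... | yes _ = refl
... | no ne' = ⊥-elim (ne' refl)

size-mapQT : ∀ f t → size (mapQT f t) ≡ size t
size-mapQT f leaf = refl
size-mapQT f (node l a q r) = cong₂ (λ x y → x ℕ.+ suc y) (size-mapQT f l) (size-mapQT f r)

hi-mapQB : ∀ f c → hi (mapQB f c) ≡ hi c
hi-mapQB f c = cong (λ z → (lo c + + z) - 1ℤ) (size-mapQT f (tree c))

mapQT-id : ∀ f t → (∀ {q} → q ∈ qlabels t → f q ≡ q) → mapQT f t ≡ t
mapQT-id f leaf h = refl
mapQT-id f (node l a q r) h = cong₂ (λ x y → node x a (proj₁ y) (proj₂ y))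
   (mapQT-id f l (λ m → h (∈-++⁺ˡ m)))
   (cong₂ _,_ (h (∈-++⁺ʳ (qlabels l) (here refl))) (mapQT-id f r (λ m → h (∈-++⁺ʳ (qlabels l) (there m)))))

node-injective : ∀ {l a q r l' a' q' r'} → node l a q r ≡ node l' a' q' r' → (l ≡ l') × (a ≡ a') × (q ≡ q') × (r ≡ r')
node-injective refl = refl , refl , refl , refl

Block-≡ : ∀ {c d} → lo c ≡ lo d → tree c ≡ tree d → c ≡ d
Block-≡ {blk lo₁ L₁ lab₁ stp₁ R₁} {blk .lo₁ L₂ lab₂ stp₂ R₂} refl e with node-injective e
... | refl , refl , refl , refl = refl

mapQB-id : ∀ f c → (∀ {q} → q ∈ qlabels (tree c) → f q ≡ q) → mapQB f c ≡ c
mapQB-id f c h = Block-≡ {mapQB f c} {c} refl (mapQT-id f (tree c) h)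

∈-mapQ⁻ : ∀ f F {c} → c ∈ mapQ f F → Σ Block (λ d → d ∈ F × c ≡ mapQB f d)
∈-mapQ⁻ f (b ∷ bs) (here e) = b , here refl , e
∈-mapQ⁻ f (b ∷ bs) (there m) with ∈-mapQ⁻ f bs m
... | d , md , e = d , there md , e

∈-mapQ⁺ : ∀ f F {d} → d ∈ F → mapQB f d ∈ mapQ f F
∈-mapQ⁺ f (b ∷ bs) (here refl) = here refl
∈-mapQ⁺ f (b ∷ bs) (there m) = there (∈-mapQ⁺ f bs m)

mapQ-sorted : ∀ f F → AllPairs Sep F → AllPairs Sep (mapQ f F)
mapQ-sorted f [] [] = []
mapQ-sorted f (b ∷ bs) (p ∷ ps) = go bs p ∷ mapQ-sorted f bs ps
  where
  go : ∀ ds → All (Sep b) ds → All (Sep (mapQB f b)) (mapQ f ds)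
  go [] [] = []
  go (d ∷ ds) (mkSep s ∷ ss) = mkSep (subst (λ z → z + 1ℤ < lo d) (sym (hi-mapQB f b)) s) ∷ go ds ss

tail-⊆ : ∀ {x xs ys} → All (Sep x) xs → (∀ {c} → c ∈ x ∷ xs → c ∈ x ∷ ys) → ∀ {c} → c ∈ xs → c ∈ ys
tail-⊆ px h m with h (there m)
... | here refl = ⊥-elim (Sep-irrefl (All.lookup px m))
... | there m' = m'

sorted-extensional : ∀ X Y → AllPairs Sep X → AllPairs Sep Y → (∀ {c} → c ∈ X → c ∈ Y) → (∀ {c} → c ∈ Y → c ∈ X) → X ≡ Y
sorted-extensional [] [] _ _ _ _ = refl
sorted-extensional [] (y ∷ ys) _ _ _ h with h (here refl)
... | ()
sorted-extensional (x ∷ xs) [] _ _ h _ with h (here refl)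
... | ()
sorted-extensional (x ∷ xs) (y ∷ ys) (px ∷ apx) (py ∷ apy) h₁ h₂ with h₁ (here refl) | h₂ (here refl)
... | here refl | _ = cong (x ∷_) (sorted-extensional xs ys apx apy (tail-⊆ px h₁) (tail-⊆ py h₂))
... | there mx | here refl = cong (y ∷_) (sorted-extensional xs ys apx apy (tail-⊆ px h₁) (tail-⊆ py h₂))
... | there mx | there my = ⊥-elim (ZP.<-asym (Sep⇒lo< (All.lookup py mx)) (Sep⇒lo< (All.lookup px my)))

-- Commuting two insertions

σ : ℕ → ℕ → ℕ
σ n = swapN n (suc n)

σ-fixes : ∀ n F → LabelsBelow n F → ∀ {c} → c ∈ F → ∀ {q} → q ∈ qlabels (tree c) → σ n q ≡ q
σ-fixes n F qb {c} mc mq with ∈-qlabels⇒node (tree c) mq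
... | p , mn = swapN-other n (suc n) _ (λ e → NP.<-irrefl e (qb (∈-nodesF⁺ F mc mn)))
                                    (λ e → NP.<-asym (qb (∈-nodesF⁺ F mc mn)) (subst (n ℕ.<_) (sym e) (NP.n<1+n n)))

mapQT-σ-maybeT : ∀ n F → LabelsBelow n F → ∀ m → (∀ {c} → m ≡ just c → c ∈ F) → mapQT (σ n) (maybeT m) ≡ maybeT m
mapQT-σ-maybeT n F qb nothing h = refl
mapQT-σ-maybeT n F qb (just c) h = mapQT-id (σ n) (tree c) (σ-fixes n F qb (h refl))

mapQB-σ-joined : ∀ n F → AllPairs Sep F → LabelsBelow n F → ∀ g x k → mapQB (σ n) (joined g x k F) ≡ joined g x (σ n k) F
mapQB-σ-joined n F ap qb g x k = Block-≡ {mapQB (σ n) (joined g x k F)} {joined g x (σ n k) F} refl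
  (cong₂ (λ l r → node l x (σ n k) r) (mapQT-σ-maybeT n F qb (leftNbr g F) (leftNbr∈ g F ap)) (mapQT-σ-maybeT n F qb (rightNbr g F) (rightNbr∈ g F ap)))

joined-cong : ∀ g x k G F → leftNbr g G ≡ leftNbr g F → rightNbr g G ≡ rightNbr g F → joined g x k G ≡ joined g x k F
joined-cong g x k G F e1 e2 rewrite e1 | e2 = refl

module Commute (F : Forest) (n : ℕ) (a b : Letter) (inv : WellFormed F) (qb : LabelsBelow n F)
               (sep : SeparatingCell F a b) where
  open SeparatingCell sep renaming
    (cell to f; cell-free to ff; side-a to s; side-b to s'; a-side to pa; b-side to pb; sides-differ to ne)
  ap = proj₁ inv
  ga = target a F
  gb = target b F
  module SA = Step a n F ap
  module SB = Step b n F ap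
  module IA = Independent F ap f ff a n b s s' pa pb ne
  module IB = Independent F ap f ff b n a s' s pb pa (λ e → ne (sym e))
  Ga = SA.G
  Gb = SB.G
  apGa = SA.join-sorted
  apGb = SB.join-sorted
  Na = SA.N
  Nb = SB.N

  a-free-after-b : Free ga Gb
  a-free-after-b = subst (λ z → Free z Gb) (trans (cong (target a) (sym SB.step≡join)) IB.target-preserved) (target-free a Gb apGb)
  b-free-after-a : Free gb Ga
  b-free-after-a = subst (λ z → Free z Ga) (trans (cong (target b) (sym SA.step≡join)) IA.target-preserved) (target-free b Ga apGa)

  module Jba = Join ga a (suc n) Gb apGb a-free-after-b
  module Jab = Join gb b (suc n) Ga apGa b-free-after-a

  step-ba≡ : step a (suc n) (step b n F) ≡ Jba.G
  step-ba≡ = trans (step≡joinAt-target a (suc n) (step b n F)) (cong₂ (λ g H → joinAt g a (suc n) H) IB.target-preserved SB.step≡join)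
  step-ab≡ : step b (suc n) (step a n F) ≡ Jab.G
  step-ab≡ = trans (step≡joinAt-target b (suc n) (step a n F)) (cong₂ (λ g H → joinAt g b (suc n) H) IA.target-preserved SA.step≡join)

  Jba-new≡ : Jba.N ≡ joined ga a (suc n) F
  Jba-new≡ = joined-cong ga a (suc n) Gb F IB.leftNbr-preserved IB.rightNbr-preserved
  Jab-new≡ : Jab.N ≡ joined gb b (suc n) F
  Jab-new≡ = joined-cong gb b (suc n) Ga F IA.leftNbr-preserved IA.rightNbr-preserved

  σn : σ n n ≡ suc n
  σn = swapN-first n (suc n)
  σsn : σ n (suc n) ≡ n
  σsn = swapN-second n (suc n) (λ e → NP.1+n≢n e)

  σ-newA : mapQB (σ n) Na ≡ Jba.N
  σ-newA = trans (mapQB-σ-joined n F ap qb ga a n) (trans (cong (λ k → joined ga a k F) σn) (sym Jba-new≡))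
  σ-newB : mapQB (σ n) Jab.N ≡ Nb
  σ-newB = trans (cong (mapQB (σ n)) Jab-new≡) (trans (mapQB-σ-joined n F ap qb gb b (suc n)) (cong (λ k → joined gb b k F) σsn))

  σ-old : ∀ {c} → c ∈ F → mapQB (σ n) c ≡ c
  σ-old mc = mapQB-id (σ n) _ (σ-fixes n F qb mc)

  ⊆-commuted : ∀ {c} → c ∈ Jba.G → c ∈ mapQ (σ n) Jab.G
  ⊆-commuted mc with Jba.∈-join⁻ mc
  ... | inj₁ refl = subst (_∈ mapQ (σ n) Jab.G) σ-newA
                      (∈-mapQ⁺ (σ n) Jab.G (Jab.∈-join⁺ SA.new∈join (IB.other-notLeftAdj n) (IB.other-notRightAdj n)))
  ... | inj₂ (mb , nh , nl) with SB.∈-join⁻ mb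
  ...   | inj₁ refl = subst (_∈ mapQ (σ n) Jab.G) σ-newB (∈-mapQ⁺ (σ n) Jab.G Jab.new∈join)
  ...   | inj₂ (mF , nh' , nl') = subst (_∈ mapQ (σ n) Jab.G) (σ-old mF)
                                    (∈-mapQ⁺ (σ n) Jab.G (Jab.∈-join⁺ (SA.∈-join⁺ mF nh nl) nh' nl'))

  ⊇-commuted : ∀ {c} → c ∈ mapQ (σ n) Jab.G → c ∈ Jba.G
  ⊇-commuted mc with ∈-mapQ⁻ (σ n) Jab.G mc
  ... | d , md , refl with Jab.∈-join⁻ md
  ...   | inj₁ refl = subst (_∈ Jba.G) (sym σ-newB) (Jba.∈-join⁺ SB.new∈join (IA.other-notLeftAdj n) (IA.other-notRightAdj n))
  ...   | inj₂ (ma , nh , nl) with SA.∈-join⁻ ma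
  ...     | inj₁ refl = subst (_∈ Jba.G) (sym σ-newA) Jba.new∈join
  ...     | inj₂ (mF , nh' , nl') = subst (_∈ Jba.G) (sym (σ-old mF)) (Jba.∈-join⁺ (SB.∈-join⁺ mF nh nl) nh' nl')

  commute : step a (suc n) (step b n F) ≡ mapQ (σ n) (step b (suc n) (step a n F))
  commute = trans step-ba≡ (trans (sorted-extensional Jba.G (mapQ (σ n) Jab.G) Jba.join-sorted (mapQ-sorted (σ n) Jab.G Jab.join-sorted) ⊆-commuted ⊇-commuted)
                              (cong (mapQ (σ n)) (sym step-ab≡)))

  child-below : ∀ {y} m → (∀ {c} → m ≡ just c → c ∈ F) → y ∈ qlabels (maybeT m) → y ℕ.< n
  child-below nothing h ()
  child-below (just c) h my with ∈-qlabels⇒node (tree c) my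
  ... | p , mn = qb (∈-nodesF⁺ F (h refl) mn)

  Fa = step a n F
  invFa = step-wellFormed a n F inv
  qbFa : LabelsBelow (suc n) Fa
  qbFa = step-labelsBelow a n F ap qb

  module StepB = StepNodes b (suc n) Fa (proj₁ invFa)
  module StepA = StepNodes a n F ap

  target-b≡ : target b Fa ≡ gb
  target-b≡ = IA.target-preserved

  leftNbr-b≡ : leftNbr (target b Fa) Fa ≡ leftNbr gb F
  leftNbr-b≡ = trans (cong₂ leftNbr target-b≡ SA.step≡join) IA.leftNbr-preserved
  rightNbr-b≡ : rightNbr (target b Fa) Fa ≡ rightNbr gb F
  rightNbr-b≡ = trans (cong₂ rightNbr target-b≡ SA.step≡join) IA.rightNbr-preserved

  children-below : ∀ g {y} → y ∈ qlabels (maybeT (leftNbr g F)) ++ qlabels (maybeT (rightNbr g F)) → y ℕ.< n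
  children-below g {y} my with ∈-++⁻ (qlabels (maybeT (leftNbr g F))) my
  ... | inj₁ m1 = child-below (leftNbr g F) (leftNbr∈ g F ap) m1
  ... | inj₂ m2 = child-below (rightNbr g F) (rightNbr∈ g F ap) m2

  children-below-b : ∀ {y} → y ∈ qlabels (maybeT (leftNbr (target b Fa) Fa)) ++ qlabels (maybeT (rightNbr (target b Fa) Fa)) → y ℕ.< n
  children-below-b my rewrite leftNbr-b≡ | rightNbr-b≡ = children-below gb my

  no-desc₁ : ¬ DescF n (suc n) (step b (suc n) Fa)
  no-desc₁ d with StepB.Desc-step⁻ d
  ... | inj₂ (e , _) = NP.1+n≢n (sym e)
  ... | inj₁ d' with StepA.Desc-step⁻ d'
  ...   | inj₁ d'' = NP.<-irrefl refl (qlabelsF-below F n qb (DescF⇒∈ d''))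
  ...   | inj₂ (_ , my) = NP.<-asym (NP.n<1+n n) (children-below ga my)

  no-desc₂ : ¬ DescF (suc n) n (step b (suc n) Fa)
  no-desc₂ d with StepB.Desc-step⁻ d
  ... | inj₂ (_ , my) = NP.<-irrefl refl (children-below-b my)
  ... | inj₁ d' = NP.<-irrefl refl (qlabelsF-below Fa (suc n) qbFa (DescF⇒∈ d'))

-- After inserting a, either the root of b adopts the new block of a (when
-- the target of b is adjacent to it), or the free cell adjacent to that
-- block on the side of b separates the targets of a and b.
module Dichotomy (F : Forest) (n : ℕ) (a b : Letter) (inv : WellFormed F) where
  ap = proj₁ inv
  module SA = Step a n F ap
  Ga = SA.G
  Na = SA.N
  apGa = SA.join-sorted
  ga = target a F
  H = hi Na
  Lo = lo Na
  Fa = step a n F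

  n∈Na : n ∈ qlabels (tree Na)
  n∈Na = ∈-++⁺ʳ (qlabels (maybeT (leftNbr ga F))) (here refl)

  InSupp-step : ∀ {i} → InSupp i F → InSupp i Ga
  InSupp-step s with InSupp⇒In s
  ... | c , mc , ic with SA.∈-step-or-nbr mc
  ... | inj₁ mg = In⇒InSupp mg ic
  ... | inj₂ (inj₁ e) = In⇒InSupp SA.new∈join (In-joined-left ga a n F SA.vL SA.vR e ic)
  ... | inj₂ (inj₂ e) = In⇒InSupp SA.new∈join (In-joined-right ga a n F SA.vL SA.vR e ic)

  Free-step⁻ : ∀ {i} → Free i Ga → Free i F
  Free-step⁻ fr s = fr (InSupp-step s)

  step-b≡join : step b (suc n) Fa ≡ joinAt (target b Ga) b (suc n) Ga
  step-b≡join = trans (step≡joinAt-target b (suc n) Fa) (cong (λ G → joinAt (target b G) b (suc n) G) SA.step≡join)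

  b-adopts-left : target b Ga ≡ H + 1ℤ → DescF (suc n) n (step b (suc n) Fa)
  b-adopts-left e rewrite step-b≡join | e =
    lose (Join.new∈join (H + 1ℤ) b (suc n) Ga apGa (Free-hi+1 apGa SA.new∈join))
      (here refl (∈-++⁺ˡ (subst (λ z → n ∈ qlabels (maybeT z)) (sym (leftNbr-hi+1 apGa SA.new∈join)) n∈Na)))

  b-adopts-right : target b Ga ≡ Lo - 1ℤ → DescF (suc n) n (step b (suc n) Fa)
  b-adopts-right e rewrite step-b≡join | e =
    lose (Join.new∈join (Lo - 1ℤ) b (suc n) Ga apGa (Free-lo-1 apGa SA.new∈join))
      (here refl (∈-++⁺ʳ (qlabels (maybeT (leftNbr (Lo - 1ℤ) Ga)))
         (subst (λ z → n ∈ qlabels (maybeT z)) (sym (rightNbr-lo-1 apGa SA.new∈join)) n∈Na)))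

  val-a∈Na : In (val a) Na
  val-a∈Na = target-labelIn a n F ap

  ga∈Na : In ga Na
  ga∈Na = In-joined-centre ga a n F SA.vL SA.vR

  freeH : Free (H + 1ℤ) F
  freeH = Free-step⁻ (Free-hi+1 apGa SA.new∈join)
  freeL : Free (Lo - 1ℤ) F
  freeL = Free-step⁻ (Free-lo-1 apGa SA.new∈join)

  ga<H+1 : ga < H + 1ℤ
  ga<H+1 = ≤⇒<+1 (inhi ga∈Na)
  L-1<ga : Lo - 1ℤ < ga
  L-1<ga = ZP.<-≤-trans (i-1<i Lo) (inlo ga∈Na)

  target-unchanged-just : ∀ {c} → c ∈ F → In (val b) c → target b Ga ≡ targetNear b c → target b F ≡ target b Ga
  target-unchanged-just mc ic e = trans (target-just b F (findBlock-complete ap mc ic)) (sym e)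

  target-unchanged-via : ∀ {c X} → c ∈ F → In (val b) c → target b Ga ≡ targetNear b c → targetNear b c ≡ X → target b F ≡ X
  target-unchanged-via mc ic e e' = trans (target-unchanged-just mc ic e) (trans e e')

  target-unchanged-nothing : findBlock (val b) Ga ≡ nothing → target b F ≡ target b Ga
  target-unchanged-nothing e with findBlock-view (val b) F
  ... | inj₂ e' = trans (target-nothing b F e') (sym (target-nothing b Ga e))
  ... | inj₁ (c , e') = ⊥-elim (findBlock-nothing (val b) Ga e (InSupp-step (In⇒InSupp (proj₁ (findBlock-just (val b) F e')) (proj₂ (findBlock-just (val b) F e')))))

  cell-right : ∀ {gb} → target b F ≡ gb → H + 1ℤ < gb → SeparatingCell F a b
  cell-right e lt = sepCell (H + 1ℤ) freeH before after ga<H+1 (subst (H + 1ℤ <_) (sym e) lt) (λ ())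

  cell-left : ∀ {gb} → target b F ≡ gb → gb < Lo - 1ℤ → SeparatingCell F a b
  cell-left e lt = sepCell (Lo - 1ℤ) freeL after before L-1<ga (subst (_< Lo - 1ℤ) (sym e) lt) (λ ())

  Outcome : Set
  Outcome = DescF (suc n) n (step b (suc n) Fa) ⊎ SeparatingCell F a b

  val-b∉Na : findBlock (val b) Ga ≡ nothing → ¬ In (val b) Na
  val-b∉Na e i = findBlock-nothing (val b) Ga e (In⇒InSupp SA.new∈join i)

  dichotomy-< : a <L b → Outcome
  dichotomy-< ab with findBlock-view (val b) Ga
  ... | inj₂ e with trichotomy (H + 1ℤ) (val b)
  ...   | inj₁ lt = inj₂ (cell-right (trans (target-unchanged-nothing e) (target-nothing b Ga e)) lt)
  ...   | inj₂ (inj₁ eq) = inj₁ (b-adopts-left (trans (target-nothing b Ga e) (sym eq)))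
  ...   | inj₂ (inj₂ gt) = ⊥-elim (val-b∉Na e (mkIn (ZP.≤-trans (inlo val-a∈Na) (<L⇒val≤ ab)) (<+1⇒≤ gt)))
  dichotomy-< ab | inj₁ (c , e) with findBlock-just (val b) Ga e
  ... | mc , ic with Sep-trichotomy apGa SA.new∈join mc
  ...   | inj₁ refl = inj₁ (b-adopts-left (trans (target-just b Ga e) (targetNear-true b Na (<L⇒ltL-true a b ab))))
  ...   | inj₂ (inj₂ (mkSep s)) = ⊥-elim (ZP.<-irrefl refl
            (ZP.<-≤-trans s (ZP.≤-trans (inlo val-a∈Na) (ZP.≤-trans (<L⇒val≤ ab) (ZP.≤-trans (inhi ic) (ZP.<⇒≤ (i<i+1 (hi c))))))))
  ...   | inj₂ (inj₁ (mkSep s)) with SA.∈-join⁻ mc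
  ...     | inj₁ refl = ⊥-elim (Sep-irrefl {Na} (mkSep s))
  ...     | inj₂ (mF , _) with ltL-true⊎false (lab c) b
  ...       | inj₁ t = inj₂ (cell-right (target-unchanged-via mF ic (target-just b Ga e) (targetNear-true b c t))
                          (ZP.<-≤-trans s (ZP.≤-trans (lo≤hi c) (ZP.<⇒≤ (i<i+1 (hi c))))))
  ...       | inj₂ t with trichotomy (H + 1ℤ) (lo c - 1ℤ)
  ...         | inj₁ lt = inj₂ (cell-right (target-unchanged-via mF ic (target-just b Ga e) (targetNear-false b c t)) lt)
  ...         | inj₂ (inj₁ eq) = inj₁ (b-adopts-left (trans (target-just b Ga e) (trans (targetNear-false b c t) (sym eq))))
  ...         | inj₂ (inj₂ gt) = ⊥-elim (ZP.<⇒≱ gt (<⇒≤-1 s))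

  dichotomy-> : b <L a → Outcome
  dichotomy-> ba with findBlock-view (val b) Ga
  ... | inj₂ e with trichotomy (val b) (Lo - 1ℤ)
  ...   | inj₁ lt = inj₂ (cell-left (trans (target-unchanged-nothing e) (target-nothing b Ga e)) lt)
  ...   | inj₂ (inj₁ eq) = inj₁ (b-adopts-right (trans (target-nothing b Ga e) eq))
  ...   | inj₂ (inj₂ gt) = ⊥-elim (val-b∉Na e (mkIn (subst (_≤ val b) (-1+1 Lo) (<⇒+1≤ gt)) (ZP.≤-trans (<L⇒val≤ ba) (inhi val-a∈Na))))
  dichotomy-> ba | inj₁ (c , e) with findBlock-just (val b) Ga e
  ... | mc , ic with Sep-trichotomy apGa mc SA.new∈join
  ...   | inj₁ refl = inj₁ (b-adopts-right (trans (target-just b Ga e) (targetNear-false b Na (>L⇒ltL-false a b ba))))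
  ...   | inj₂ (inj₂ (mkSep s)) = ⊥-elim (ZP.<-irrefl refl
            (ZP.<-≤-trans s (ZP.≤-trans (inlo ic) (ZP.≤-trans (<L⇒val≤ ba) (ZP.≤-trans (inhi val-a∈Na) (ZP.<⇒≤ (i<i+1 H)))))))
  ...   | inj₂ (inj₁ (mkSep s)) with SA.∈-join⁻ mc
  ...     | inj₁ refl = ⊥-elim (Sep-irrefl {Na} (mkSep s))
  ...     | inj₂ (mF , _) with ltL-true⊎false (lab c) b
  ...       | inj₂ t = inj₂ (cell-left (target-unchanged-via mF ic (target-just b Ga e) (targetNear-false b c t))
                          (ZP.+-monoˡ-< (Z.- 1ℤ) (ZP.≤-<-trans (lo≤hi c) (ZP.<-trans (i<i+1 (hi c)) s))))
  ...       | inj₁ t with trichotomy (hi c + 1ℤ) (Lo - 1ℤ)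
  ...         | inj₁ lt = inj₂ (cell-left (target-unchanged-via mF ic (target-just b Ga e) (targetNear-true b c t)) lt)
  ...         | inj₂ (inj₁ eq) = inj₁ (b-adopts-right (trans (target-just b Ga e) (trans (targetNear-true b c t) eq)))
  ...         | inj₂ (inj₂ gt) = ⊥-elim (ZP.<⇒≱ gt (<⇒≤-1 s))

  dichotomy : ¬ (a ≡ b) → Outcome
  dichotomy ne with ltL-true⊎false a b
  ... | inj₁ t = dichotomy-< (ltL-true⇒<L a b t)
  ... | inj₂ t = dichotomy-> (≮L∧≢⇒>L a b (ltL-false⇒≮L a b t) ne)

-- Rootlists and separating cells

InRootlist : Forest → Ext → Set
InRootlist F e = Any (λ b → e ≡ over (lab b)) F
  ⊎ Σ ℤ (λ i → (e ≡ under i) × ¬ InSupp (i Z.- Z.1ℤ) F × ¬ InSupp i F)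

RootlistSeparates : Forest → Letter → Letter → Set
RootlistSeparates F x y = Σ Ext λ r₁ → Σ Ext λ r₂ → InRootlist F r₁ × InRootlist F r₂ × (r₁ <E r₂) × (over x <E r₁) × (r₂ <E over y)

LeftOf : ℤ → Ext → Set
LeftOf f (over a) = val a < f
LeftOf f (under i) = i ≤ f

RightOf : ℤ → Ext → Set
RightOf f (over a) = f < val a
RightOf f (under i) = f < i

LeftOf∧RightOf⇒<E : ∀ {f r r'} → LeftOf f r → RightOf f r' → r <E r'
LeftOf∧RightOf⇒<E {r = over a} {over b} p q = inj₁ (ZP.<-trans p q)
LeftOf∧RightOf⇒<E {r = over a} {under j} p q = ZP.<-trans p q
LeftOf∧RightOf⇒<E {r = under i} {over b} p q = ZP.<⇒≤ (ZP.≤-<-trans p q)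
LeftOf∧RightOf⇒<E {r = under i} {under j} p q = ZP.≤-<-trans p q

module Rootlist (F : Forest) (inv : WellFormed F) where
  ap = proj₁ inv
  labIn : ∀ {c} → c ∈ F → LabelIn c
  labIn mc = All.lookup (proj₂ inv) mc

  notIn-lo : ∀ {c f} → c ∈ F → Free f F → lo c ≤ f → hi c < f
  notIn-lo {c} {f} mc ff le with trichotomy (hi c) f
  ... | inj₁ lt = lt
  ... | inj₂ (inj₁ e) = ⊥-elim (ff (In⇒InSupp mc (mkIn le (ZP.≤-reflexive (sym e)))))
  ... | inj₂ (inj₂ gt) = ⊥-elim (ff (In⇒InSupp mc (mkIn le (ZP.<⇒≤ gt))))

  notIn-hi : ∀ {c f} → c ∈ F → Free f F → f ≤ hi c → f < lo c
  notIn-hi {c} {f} mc ff le with trichotomy f (lo c)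
  ... | inj₁ lt = lt
  ... | inj₂ (inj₁ e) = ⊥-elim (ff (In⇒InSupp mc (mkIn (ZP.≤-reflexive (sym e)) le)))
  ... | inj₂ (inj₂ gt) = ⊥-elim (ff (In⇒InSupp mc (mkIn (ZP.<⇒≤ gt) le)))

  module AfterTarget (x : Letter) (dx : ∀ {c} → c ∈ F → ¬ (lab c ≡ x)) where
    gx = target x F

    x-under : Free (gx + 1ℤ) F → val x < gx + 1ℤ
    x-under fr with findBlock-view (val x) F
    ... | inj₂ e rewrite target-nothing x F e = i<i+1 (val x)
    ... | inj₁ (b , e) with findBlock-just (val x) F e
    ...   | mb , ib rewrite target-just x F e with ltL-true⊎false (lab b) x
    ...     | inj₁ t rewrite targetNear-true x b t = ZP.≤-<-trans (inhi ib) (ZP.<-trans (i<i+1 (hi b)) (i<i+1 (hi b + 1ℤ)))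
    ...     | inj₂ t rewrite targetNear-false x b t = ⊥-elim (fr (In⇒InSupp mb (mkIn (ZP.≤-reflexive (sym (-1+1 (lo b)))) (subst (_≤ hi b) (sym (-1+1 (lo b))) (lo≤hi b)))))

    x-root : ∀ {c} → c ∈ F → lo c ≡ gx + 1ℤ → x <L lab c
    x-root {c} mc h with findBlock-view (val x) F
    ... | inj₂ e rewrite target-nothing x F e = inj₁ (+1≤⇒< (subst (_≤ val (lab c)) h (inlo (labIn mc))))
    ... | inj₁ (b , e) with findBlock-just (val x) F e
    ...   | mb , ib rewrite target-just x F e with ltL-true⊎false (lab b) x
    ...     | inj₁ t rewrite targetNear-true x b t = inj₁ (ZP.≤-<-trans (inhi ib)
               (ZP.<-≤-trans (ZP.<-trans (i<i+1 (hi b)) (i<i+1 (hi b + 1ℤ))) (subst (_≤ val (lab c)) h (inlo (labIn mc)))))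
    ...     | inj₂ t rewrite targetNear-false x b t with lo-injective ap mc mb (trans h (-1+1 (lo b)))
    ...       | refl = ≮L∧≢⇒>L (lab c) x (ltL-false⇒≮L (lab c) x t) (dx mc)

  module BeforeTarget (y : Letter) where
    gy = target y F

    y-under : Free (gy - 1ℤ) F → gy ≤ val y
    y-under fr with findBlock-view (val y) F
    ... | inj₂ e rewrite target-nothing y F e = ZP.≤-refl
    ... | inj₁ (b , e) with findBlock-just (val y) F e
    ...   | mb , ib rewrite target-just y F e with ltL-true⊎false (lab b) y
    ...     | inj₁ t rewrite targetNear-true y b t = ⊥-elim (fr (In⇒InSupp mb (mkIn (subst (lo b ≤_) (sym (+1-1 (hi b))) (lo≤hi b)) (ZP.≤-reflexive (+1-1 (hi b))))))
    ...     | inj₂ t rewrite targetNear-false y b t = ZP.≤-trans (ZP.<⇒≤ (i-1<i (lo b))) (inlo ib)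

    y-root : ∀ {d} → d ∈ F → hi d ≡ gy - 1ℤ → lab d <L y
    y-root {d} md h with findBlock-view (val y) F
    ... | inj₂ e rewrite target-nothing y F e = inj₁ (≤-1⇒< (subst (val (lab d) ≤_) h (inhi (labIn md))))
    ... | inj₁ (b , e) with findBlock-just (val y) F e
    ...   | mb , ib rewrite target-just y F e with ltL-true⊎false (lab b) y
    ...     | inj₁ t rewrite targetNear-true y b t with hi-injective ap md mb (trans h (+1-1 (hi b)))
    ...       | refl = ltL-true⇒<L (lab d) y t
    y-root {d} md h | inj₁ (b , e) | mb , ib | inj₂ t rewrite targetNear-false y b t =
       inj₁ (ZP.≤-<-trans (inhi (labIn md)) (ZP.<-≤-trans (subst (_< lo b) (sym h) (ZP.<-trans (i-1<i (lo b - 1ℤ)) (i-1<i (lo b)))) (inlo ib)))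

  lo-eq : ∀ {c g} → c ∈ F → In (g + 1ℤ) c → Free g F → lo c ≡ g + 1ℤ
  lo-eq {c} {g} mc ic fr with trichotomy (lo c) (g + 1ℤ)
  ... | inj₁ lt = ⊥-elim (fr (In⇒InSupp mc (mkIn (<+1⇒≤ lt) (ZP.≤-trans (ZP.<⇒≤ (i<i+1 g)) (inhi ic)))))
  ... | inj₂ (inj₁ e) = e
  ... | inj₂ (inj₂ gt) = ⊥-elim (ZP.<⇒≱ gt (inlo ic))

  hi-eq : ∀ {d g} → d ∈ F → In (g - 1ℤ) d → Free g F → hi d ≡ g - 1ℤ
  hi-eq {d} {g} md id fr with trichotomy (hi d) (g - 1ℤ)
  ... | inj₁ lt = ⊥-elim (ZP.<⇒≱ lt (inhi id))
  ... | inj₂ (inj₁ e) = e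
  ... | inj₂ (inj₂ gt) = ⊥-elim (fr (In⇒InSupp md (mkIn (ZP.≤-trans (inlo id) (ZP.<⇒≤ (i-1<i g))) (subst (_≤ hi d) (-1+1 g) (<⇒+1≤ gt)))))

  first-after : ∀ x → (∀ {c} → c ∈ F → ¬ (lab c ≡ x)) → ∀ f → Free f F → target x F < f →
                Σ Ext λ r → InRootlist F r × over x <E r × LeftOf f r
  first-after x dx f ff xf with findBlock-view (target x F + 1ℤ) F
  ... | inj₂ e = under (gx + 1ℤ)
               , inj₂ (gx + 1ℤ , refl , subst (λ z → Free z F) (sym (+1-1 gx)) (target-free x F ap) , findBlock-nothing _ F e)
               , x-under (findBlock-nothing _ F e) , <⇒+1≤ xf
    where open AfterTarget x dx
  ... | inj₁ (c , e) with findBlock-just _ F e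
  ...   | mc , ic = over (lab c) , inj₁ (lose mc refl) , x-root mc lo≡ ,
                    ZP.≤-<-trans (inhi (labIn mc)) (notIn-lo mc ff (ZP.≤-trans (ZP.≤-reflexive lo≡) (<⇒+1≤ xf)))
    where
    open AfterTarget x dx
    lo≡ : lo c ≡ gx + 1ℤ
    lo≡ = lo-eq mc ic (target-free x F ap)

  last-before : ∀ y f → Free f F → f < target y F →
                Σ Ext λ r → InRootlist F r × r <E over y × RightOf f r
  last-before y f ff fy with findBlock-view (target y F - 1ℤ) F
  ... | inj₂ e = under gy , inj₂ (gy , refl , findBlock-nothing _ F e , target-free y F ap)
               , y-under (findBlock-nothing _ F e) , fy
    where open BeforeTarget y
  ... | inj₁ (d , e) with findBlock-just _ F e
  ...   | md , id = over (lab d) , inj₁ (lose md refl) , y-root md (hi-eq md id (target-free y F ap)) ,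
                    ZP.<-≤-trans (notIn-hi md ff (ZP.≤-trans (<⇒≤-1 fy) (inhi id))) (inlo (labIn md))
    where open BeforeTarget y

  cell⇒rootlist : ∀ x y → (∀ {c} → c ∈ F → ¬ (lab c ≡ x)) → ∀ f → Free f F → target x F < f → f < target y F →
                  RootlistSeparates F x y
  cell⇒rootlist x y dx f ff xf fy =
    let (r₁ , p₁ , x<r₁ , r₁≤f) = first-after x dx f ff xf
        (r₂ , p₂ , r₂<y , f<r₂) = last-before y f ff fy
    in r₁ , r₂ , p₁ , p₂ , LeftOf∧RightOf⇒<E r₁≤f f<r₂ , x<r₁ , r₂<y

  -- A root is flanked by the free cells just outside its block, \underline{i}
  -- by the cells i - 1 and i.
  cellBefore : ∀ {r} → InRootlist F r → ℤ
  cellBefore (inj₁ p) = lo (proj₁ (find p)) - 1ℤ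
  cellBefore (inj₂ (i , _)) = i - 1ℤ

  cellAfter : ∀ {r} → InRootlist F r → ℤ
  cellAfter (inj₁ p) = hi (proj₁ (find p)) + 1ℤ
  cellAfter (inj₂ (i , _)) = i

  cellBefore<cellAfter : ∀ {r} (p : InRootlist F r) → cellBefore p < cellAfter p
  cellBefore<cellAfter (inj₁ p) = let c = proj₁ (find p) in ZP.<-≤-trans (i-1<i (lo c)) (ZP.≤-trans (lo≤hi c) (ZP.<⇒≤ (i<i+1 (hi c))))
  cellBefore<cellAfter (inj₂ (i , _)) = i-1<i i

  cellAfter-free : ∀ {r} (p : InRootlist F r) → Free (cellAfter p) F
  cellAfter-free (inj₁ p) = Free-hi+1 ap (proj₁ (proj₂ (find p)))
  cellAfter-free (inj₂ (i , _ , _ , fi)) = fi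

  target≤cellBefore : ∀ x {r} (p : InRootlist F r) → over x <E r → target x F ≤ cellBefore p
  target≤cellBefore x (inj₁ p) h with find p
  ... | c , mc , refl with findBlock-view (val x) F
  ...   | inj₂ e rewrite target-nothing x F e =
          <⇒≤-1 (notIn-hi mc (findBlock-nothing _ F e) (ZP.≤-trans (<L⇒val≤ h) (inhi (labIn mc))))
  ...   | inj₁ (b , e) with findBlock-just (val x) F e
  ...     | mb , ib rewrite target-just x F e with ltL-true⊎false (lab b) x | Sep-trichotomy ap mb mc
  ...       | inj₁ t | inj₁ refl = ⊥-elim (<L-irrefl (<L-trans h (ltL-true⇒<L (lab b) x t)))
  ...       | inj₂ t | inj₁ refl rewrite targetNear-false x b t = ZP.≤-refl
  ...       | inj₁ t | inj₂ (inj₁ (mkSep s)) rewrite targetNear-true x b t = <⇒≤-1 s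
  ...       | inj₂ t | inj₂ (inj₁ s) rewrite targetNear-false x b t = ZP.+-monoˡ-≤ (Z.- 1ℤ) (ZP.<⇒≤ (Sep⇒lo< {b} {c} s))
  ...       | _ | inj₂ (inj₂ (mkSep s)) = ⊥-elim (ZP.<-irrefl refl (ZP.<-≤-trans s
               (ZP.≤-trans (inlo ib) (ZP.≤-trans (<L⇒val≤ h) (ZP.≤-trans (inhi (labIn mc)) (ZP.<⇒≤ (i<i+1 (hi c))))))))
  target≤cellBefore x (inj₂ (i , refl , fi1 , fi)) h with findBlock-view (val x) F
  ... | inj₂ e rewrite target-nothing x F e = <⇒≤-1 h
  ... | inj₁ (b , e) with findBlock-just (val x) F e
  ...   | mb , ib rewrite target-just x F e with ltL-true⊎false (lab b) x
  ...     | inj₁ t rewrite targetNear-true x b t = <⇒+1≤ (notIn-lo mb fi1 (ZP.≤-trans (inlo ib) (<⇒≤-1 h)))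
  ...     | inj₂ t rewrite targetNear-false x b t = ZP.+-monoˡ-≤ (Z.- 1ℤ) (ZP.≤-trans (inlo ib) (ZP.<⇒≤ h))

  cellAfter≤target : ∀ y {r} (p : InRootlist F r) → r <E over y → cellAfter p ≤ target y F
  cellAfter≤target y (inj₁ p) h with find p
  ... | c , mc , refl with findBlock-view (val y) F
  ...   | inj₂ e rewrite target-nothing y F e =
          <⇒+1≤ (notIn-lo mc (findBlock-nothing _ F e) (ZP.≤-trans (inlo (labIn mc)) (<L⇒val≤ h)))
  ...   | inj₁ (b , e) with findBlock-just (val y) F e
  ...     | mb , ib rewrite target-just y F e with ltL-true⊎false (lab b) y | Sep-trichotomy ap mc mb
  ...       | inj₁ t | inj₁ refl rewrite targetNear-true y b t = ZP.≤-refl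
  ...       | inj₂ t | inj₁ refl = ⊥-elim (ltL-false⇒≮L (lab b) y t h)
  ...       | inj₁ t | inj₂ (inj₁ (mkSep s)) rewrite targetNear-true y b t =
               ZP.<⇒≤ (ZP.<-≤-trans s (ZP.≤-trans (lo≤hi b) (ZP.<⇒≤ (i<i+1 (hi b)))))
  ...       | inj₂ t | inj₂ (inj₁ (mkSep s)) rewrite targetNear-false y b t = <⇒≤-1 s
  ...       | _ | inj₂ (inj₂ (mkSep s)) = ⊥-elim (ZP.<-irrefl refl (ZP.<-≤-trans s
               (ZP.≤-trans (inlo (labIn mc)) (ZP.≤-trans (<L⇒val≤ h) (ZP.≤-trans (inhi ib) (ZP.<⇒≤ (i<i+1 (hi b))))))))
  cellAfter≤target y (inj₂ (i , refl , fi1 , fi)) h with findBlock-view (val y) F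
  ... | inj₂ e rewrite target-nothing y F e = h
  ... | inj₁ (b , e) with findBlock-just (val y) F e
  ...   | mb , ib rewrite target-just y F e with ltL-true⊎false (lab b) y
  ...     | inj₁ t rewrite targetNear-true y b t = ZP.≤-trans h (ZP.≤-trans (inhi ib) (ZP.<⇒≤ (i<i+1 (hi b))))
  ...     | inj₂ t rewrite targetNear-false y b t = <⇒≤-1 (notIn-hi mb fi (ZP.≤-trans h (inhi ib)))

  cellAfter≤cellBefore : ∀ {r₁ r₂} (p : InRootlist F r₁) (q : InRootlist F r₂) → r₁ <E r₂ → cellAfter p ≤ cellBefore q
  cellAfter≤cellBefore (inj₁ p) (inj₁ q) h with find p | find q
  ... | c , mc , refl | d , md , refl with Sep-trichotomy ap mc md
  ...   | inj₁ refl = ⊥-elim (<L-irrefl h)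
  ...   | inj₂ (inj₁ (mkSep s)) = <⇒≤-1 s
  ...   | inj₂ (inj₂ (mkSep s)) = ⊥-elim (ZP.<-irrefl refl (ZP.<-≤-trans s
            (ZP.≤-trans (inlo (labIn mc)) (ZP.≤-trans (<L⇒val≤ h) (ZP.≤-trans (inhi (labIn md)) (ZP.<⇒≤ (i<i+1 (hi d))))))))
  cellAfter≤cellBefore (inj₁ p) (inj₂ (j , refl , fj1 , fj)) h with find p
  ... | c , mc , refl = <⇒+1≤ (notIn-lo mc fj1 (ZP.≤-trans (inlo (labIn mc)) (<⇒≤-1 h)))
  cellAfter≤cellBefore (inj₂ (i , refl , fi1 , fi)) (inj₁ q) h with find q
  ... | d , md , refl = <⇒≤-1 (notIn-hi md fi (ZP.≤-trans h (inhi (labIn md))))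
  cellAfter≤cellBefore (inj₂ (i , refl , _ , _)) (inj₂ (j , refl , _ , _)) h = <⇒≤-1 h

  rootlist⇒cell : ∀ x y r₁ r₂ → InRootlist F r₁ → InRootlist F r₂ → r₁ <E r₂ → over x <E r₁ → r₂ <E over y →
          Σ ℤ λ f → Free f F × target x F < f × f < target y F
  rootlist⇒cell x y r₁ r₂ p q h12 hx hy =
    cellAfter p , cellAfter-free p , ZP.≤-<-trans (target≤cellBefore x p hx) (cellBefore<cellAfter p) ,
    ZP.≤-<-trans (cellAfter≤cellBefore p q h12) (ZP.<-≤-trans (cellBefore<cellAfter q) (cellAfter≤target y q hy))

-- Insertion commutes with relabelling larger Q-labels

module Relabel (f : ℕ → ℕ) where

  findBlock-mapQ : ∀ i F → findBlock i (mapQ f F) ≡ M.map (mapQB f) (findBlock i F)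
  findBlock-mapQ i [] = refl
  findBlock-mapQ i (b ∷ bs) with lo b Z.≤? i | i Z.≤? hi b | i Z.≤? hi (mapQB f b)
  ... | yes p | yes q | yes q' = refl
  ... | yes p | yes q | no q' = ⊥-elim (q' (subst (i ≤_) (sym (hi-mapQB f b)) q))
  ... | yes p | no q | yes q' = ⊥-elim (q (subst (i ≤_) (hi-mapQB f b) q'))
  ... | yes p | no q | no q' = findBlock-mapQ i bs
  ... | no p | _ | _ = findBlock-mapQ i bs

  targetNear-mapQ : ∀ y b → targetNear y (mapQB f b) ≡ targetNear y b
  targetNear-mapQ y b with ltL (lab b) y
  ... | true = cong (_+ 1ℤ) (hi-mapQB f b)
  ... | false = refl

  target-mapQ : ∀ y F → target y (mapQ f F) ≡ target y F
  target-mapQ y F rewrite findBlock-mapQ (val y) F with findBlock (val y) F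
  ... | nothing = refl
  ... | just b = targetNear-mapQ y b

  extractHi-mapQ : ∀ h F → extractHi h (mapQ f F) ≡ (M.map (mapQB f) (proj₁ (extractHi h F)) , mapQ f (proj₂ (extractHi h F)))
  extractHi-mapQ h [] = refl
  extractHi-mapQ h (b ∷ bs) with hi b Z.≟ h | hi (mapQB f b) Z.≟ h
  ... | yes p | yes q = refl
  ... | yes p | no q = ⊥-elim (q (trans (hi-mapQB f b) p))
  ... | no p | yes q = ⊥-elim (p (trans (sym (hi-mapQB f b)) q))
  ... | no p | no q rewrite extractHi-mapQ h bs = refl

  extractLo-mapQ : ∀ h F → extractLo h (mapQ f F) ≡ (M.map (mapQB f) (proj₁ (extractLo h F)) , mapQ f (proj₂ (extractLo h F)))
  extractLo-mapQ h [] = refl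
  extractLo-mapQ h (b ∷ bs) with lo b Z.≟ h
  ... | yes p = refl
  ... | no p rewrite extractLo-mapQ h bs = refl

  insertBlock-mapQ : ∀ b F → insertBlock (mapQB f b) (mapQ f F) ≡ mapQ f (insertBlock b F)
  insertBlock-mapQ b [] = refl
  insertBlock-mapQ b (c ∷ cs) with lo b Z.<? lo c
  ... | yes _ = refl
  ... | no _ = cong (mapQB f c ∷_) (insertBlock-mapQ b cs)

  maybe-lo-mapQB : ∀ g m → maybe {B = λ _ → ℤ} lo g (M.map (mapQB f) m) ≡ maybe {B = λ _ → ℤ} lo g m
  maybe-lo-mapQB g nothing = refl
  maybe-lo-mapQB g (just x) = refl

  maybe-tree-mapQB : ∀ m → maybe {B = λ _ → Tree} tree leaf (M.map (mapQB f) m) ≡ mapQT f (maybe {B = λ _ → Tree} tree leaf m)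
  maybe-tree-mapQB nothing = refl
  maybe-tree-mapQB (just x) = refl

  joinAt-mapQ : ∀ g c m F → f m ≡ m → joinAt g c m (mapQ f F) ≡ mapQ f (joinAt g c m F)
  joinAt-mapQ g c m F fm
    rewrite extractHi-mapQ (g - 1ℤ) F | extractLo-mapQ (g + 1ℤ) (proj₂ (extractHi (g - 1ℤ) F))
          | maybe-lo-mapQB g (proj₁ (extractHi (g - 1ℤ) F))
          | maybe-tree-mapQB (proj₁ (extractHi (g - 1ℤ) F))
          | maybe-tree-mapQB (proj₁ (extractLo (g + 1ℤ) (proj₂ (extractHi (g - 1ℤ) F))))
          = trans (cong (λ z → insertBlock (blk _ (mapQT f (maybe tree leaf (proj₁ (extractHi (g - 1ℤ) F)))) c z
                                                  (mapQT f (maybe tree leaf (proj₁ (extractLo (g + 1ℤ) (proj₂ (extractHi (g - 1ℤ) F)))))))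
                                         (mapQ f (proj₂ (extractLo (g + 1ℤ) (proj₂ (extractHi (g - 1ℤ) F)))))) (sym fm))
                  (insertBlock-mapQ _ (proj₂ (extractLo (g + 1ℤ) (proj₂ (extractHi (g - 1ℤ) F)))))

  step-mapQ : ∀ c m F → f m ≡ m → step c m (mapQ f F) ≡ mapQ f (step c m F)
  step-mapQ c m F fm = trans (step≡joinAt-target c m (mapQ f F))
    (trans (cong (λ g → joinAt g c m (mapQ f F)) (target-mapQ c F))
    (trans (joinAt-mapQ (target c F) c m F fm) (cong (mapQ f) (sym (step≡joinAt-target c m F)))))

  insGo-mapQ : ∀ m F V → (∀ j → m ℕ.≤ j → f j ≡ j) → insGo m (mapQ f F) V ≡ mapQ f (insGo m F V)
  insGo-mapQ m F [] h = refl
  insGo-mapQ m F (c ∷ V) h = trans (cong (λ G → insGo (suc m) G V) (step-mapQ c m F (h m NP.≤-refl)))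
    (insGo-mapQ (suc m) (step c m F) V (λ j le → h j (NP.<⇒≤ le)))

mapFst : (ℕ → ℕ) → Node → Node
mapFst f (q , p) = f q , p

nodesT-map : ∀ f t → nodesT (mapQT f t) ≡ map (mapFst f) (nodesT t)
nodesT-map f leaf = refl
nodesT-map f (node l a q r) rewrite map-++ (mapFst f) (nodesT l) ((q , a) ∷ nodesT r) | nodesT-map f l | nodesT-map f r = refl

nodesF-map : ∀ f F → nodesF (mapQ f F) ≡ map (mapFst f) (nodesF F)
nodesF-map f [] = refl
nodesF-map f (b ∷ bs) rewrite map-++ (mapFst f) (nodesT (tree b)) (nodesF bs) | nodesF-map f bs
  | nodesT-map f (tree b) = refl

∈-nodes-mapQ⁻ : ∀ f F {q p} → (q , p) ∈ nodesF (mapQ f F) → Σ ℕ (λ q' → (q' , p) ∈ nodesF F × q ≡ f q')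
∈-nodes-mapQ⁻ f F {q} {p} m with ∈-map⁻ (mapFst f) (subst ((q , p) ∈_) (nodesF-map f F) m)
... | (q' , p') , m' , refl = q' , m' , refl

∈-nodes-mapQ⁺ : ∀ f F {q p} → (q , p) ∈ nodesF F → (f q , p) ∈ nodesF (mapQ f F)
∈-nodes-mapQ⁺ f F {q} {p} m = subst ((f q , p) ∈_) (sym (nodesF-map f F)) (∈-map⁺ (mapFst f) m)

swap-suc : ∀ i t → swapN (suc i) (suc (suc i)) (suc t) ≡ suc (swapN i (suc i) t)
swap-suc i t with t ℕ.≟ i
... | yes refl = swapN-first (suc i) (suc (suc i))
... | no n1 with t ℕ.≟ suc i
... | yes refl = swapN-second (suc i) (suc (suc i)) (λ e → NP.1+n≢n (NP.suc-injective e))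
... | no n2 = swapN-other (suc i) (suc (suc i)) (suc t) (λ e → n1 (NP.suc-injective e)) (λ e → n2 (NP.suc-injective e))

swap-inv : ∀ i t → swapN i (suc i) (swapN i (suc i) t) ≡ t
swap-inv zero zero = refl
swap-inv zero (suc zero) = refl
swap-inv zero (suc (suc t)) = refl
swap-inv (suc i) zero = refl
swap-inv (suc i) (suc t) = trans (cong (swapN (suc i) (suc (suc i))) (swap-suc i t))
                             (trans (swap-suc i (swapN i (suc i) t)) (cong suc (swap-inv i t)))

nth-swap : ∀ {A : Set} (U : List A) a b V j →
  nth (U ++ a ∷ b ∷ V) (swapN (length U) (suc (length U)) j) ≡ nth (U ++ b ∷ a ∷ V) j
nth-swap [] a b V zero = refl
nth-swap [] a b V (suc zero) = refl
nth-swap [] a b V (suc (suc j)) = refl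
nth-swap (u ∷ U) a b V zero = refl
nth-swap (u ∷ U) a b V (suc j) rewrite swap-suc (length U) j = nth-swap U a b V j

nth-ext : ∀ {A : Set} (X Y : List A) → (∀ j → nth X j ≡ nth Y j) → X ≡ Y
nth-ext [] [] h = refl
nth-ext [] (y ∷ Y) h with h 0
... | ()
nth-ext (x ∷ X) [] h with h 0
... | ()
nth-ext (x ∷ X) (y ∷ Y) h with h 0
... | refl = cong (x ∷_) (nth-ext X Y (λ j → h (suc j)))

nth-split : ∀ {A : Set} (W : List A) i {a b} → nth W i ≡ just a → nth W (suc i) ≡ just b →
  Σ (List A) λ U → Σ (List A) λ V → (W ≡ U ++ a ∷ b ∷ V) × (length U ≡ i)
nth-split (x ∷ y ∷ W) zero refl refl = [] , W , refl , refl
nth-split (x ∷ W) (suc i) e1 e2 with nth-split W i e1 e2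
... | U , V , refl , refl = x ∷ U , V , refl , refl

nth-∈ : ∀ {A : Set} (W : List A) i {a} → nth W i ≡ just a → a ∈ W
nth-∈ (x ∷ W) zero refl = here refl
nth-∈ (x ∷ W) (suc i) e = there (nth-∈ W i e)

Unique-drop : ∀ {A : Set} (U : List A) {ys} → Unique (U ++ ys) → Unique ys
Unique-drop [] u = u
Unique-drop (x ∷ U) (_ ∷ u) = Unique-drop U u

Unique⇒∉prefix : ∀ {A : Set} (U : List A) {a ys} → Unique (U ++ a ∷ ys) → ¬ (a ∈ U)
Unique⇒∉prefix (x ∷ U) (px ∷ u) (here refl) = lookAll U px
  where
  lookAll : ∀ U' {ys'} → All (λ z → ¬ (x ≡ z)) (U' ++ x ∷ ys') → ⊥
  lookAll [] (p ∷ _) = p refl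
  lookAll (_ ∷ U') (_ ∷ ps) = lookAll U' ps
Unique⇒∉prefix (x ∷ U) (px ∷ u) (there m) = Unique⇒∉prefix U u m

Unique⇒∉prefix₂ : ∀ {A : Set} (U : List A) {a b V} → Unique (U ++ a ∷ b ∷ V) → ¬ (b ∈ U)
Unique⇒∉prefix₂ U {a} {b} {V} u m = Unique⇒∉prefix (U ++ (a ∷ [])) (subst Unique (sym (++-assoc U (a ∷ []) (b ∷ V))) u)
  (∈-++⁺ˡ m)

Unique⇒≢ : ∀ {A : Set} (U : List A) {a b V} → Unique (U ++ a ∷ b ∷ V) → ¬ (a ≡ b)
Unique⇒≢ U u with Unique-drop U u
... | (p ∷ _) ∷ _ = p

ins-++ : ∀ U a b V → ins (U ++ a ∷ b ∷ V) ≡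
  insGo (suc (suc (suc (length U)))) (step b (suc (suc (length U))) (step a (suc (length U)) (ins U))) V
ins-++ U a b V = insGo-++ 1 [] U (a ∷ b ∷ V)

root-label∈word : ∀ U {c} → c ∈ ins U → lab c ∈ U
root-label∈word U {c} mc with ∈-nodes-ins⁻ U (∈-nodesF⁺ (ins U) mc (∈-++⁺ʳ (nodesT (L c)) (here refl)))
... | i , _ , e = nth-∈ U i e

SeparatedSwap : List Letter → List Letter → Set
SeparatedSwap W W' = ∃ λ U → ∃ λ V → ∃ λ a → ∃ λ b →
        (W ≡ U ++ (a ∷ b ∷ V)) × (W' ≡ U ++ (b ∷ a ∷ V))
      × (∃ λ r₁ → ∃ λ r₂ → InRL U r₁ × InRL U r₂ × (r₁ <E r₂)
          × (((over a <E r₁) × (r₂ <E over b)) ⊎ ((over b <E r₁) × (r₂ <E over a))))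

nth-length : ∀ {A : Set} (U : List A) a ys → nth (U ++ a ∷ ys) (length U) ≡ just a
nth-length [] a ys = refl
nth-length (u ∷ U) a ys = nth-length U a ys

nth-suc-length : ∀ {A : Set} (U : List A) a b V → nth (U ++ a ∷ b ∷ V) (suc (length U)) ≡ just b
nth-suc-length [] a b V = refl
nth-suc-length (u ∷ U) a b V = nth-suc-length U a b V

σ-fixes-beyond : ∀ k j → suc (suc k) ℕ.≤ j → swapN k (suc k) j ≡ j
σ-fixes-beyond k j le = swapN-other k (suc k) j (λ e → NP.<-irrefl (sym e) (NP.<-trans (NP.n<1+n k) le))
                                   (λ e → NP.<-irrefl (sym e) le)

rootlist⇒separatingCell : ∀ U a b r₁ r₂ → InRL U r₁ → InRL U r₂ → r₁ <E r₂ →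
  ((over a <E r₁) × (r₂ <E over b)) ⊎ ((over b <E r₁) × (r₂ <E over a)) → SeparatingCell (ins U) a b
rootlist⇒separatingCell U a b r₁ r₂ p₁ p₂ r₁<r₂ (inj₁ (a<r₁ , r₂<b)) =
  let (f , ff , a<f , f<b) = Rootlist.rootlist⇒cell (ins U) (ins-wellFormed U) a b r₁ r₂ p₁ p₂ r₁<r₂ a<r₁ r₂<b
  in sepCell f ff before after a<f f<b (λ ())
rootlist⇒separatingCell U a b r₁ r₂ p₁ p₂ r₁<r₂ (inj₂ (b<r₁ , r₂<a)) =
  let (f , ff , b<f , f<a) = Rootlist.rootlist⇒cell (ins U) (ins-wellFormed U) b a r₁ r₂ p₁ p₂ r₁<r₂ b<r₁ r₂<a
  in sepCell f ff after before f<a b<f (λ ())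

separatedSwap⇒∼ : ∀ W W' → SeparatedSwap W W' → W ∼ W'
separatedSwap⇒∼ .(U ++ a ∷ b ∷ V) .(U ++ b ∷ a ∷ V) (U , V , a , b , refl , refl , r₁ , r₂ , p₁ , p₂ , r₁<r₂ , between) =
  k , kIn , k1In , nd1 , nd2 , eqF
  where
  k = suc (length U)
  F = ins U
  inv = ins-wellFormed U
  qb = ins-labelsBelow U
  W = U ++ a ∷ b ∷ V
  W' = U ++ b ∷ a ∷ V
  module C = Commute F k a b inv qb (rootlist⇒separatingCell U a b r₁ r₂ p₁ p₂ r₁<r₂ between)

  Fab = step b (suc k) (step a k F)
  invFab : WellFormed Fab
  invFab = step-wellFormed b (suc k) (step a k F) (step-wellFormed a k F inv)

  eW : ins W ≡ insGo (suc (suc k)) Fab V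
  eW = ins-++ U a b V
  eW' : ins W' ≡ insGo (suc (suc k)) (step a (suc k) (step b k F)) V
  eW' = ins-++ U b a V

  kIn : k ∈ qlabelsF (ins W)
  kIn = node⇒∈-qlabelsF (ins W) (∈-nodes-ins⁺ W (length U , refl , nth-length U a (b ∷ V)))

  k1In : suc k ∈ qlabelsF (ins W)
  k1In = node⇒∈-qlabelsF (ins W) (∈-nodes-ins⁺ W (suc (length U) , refl , nth-suc-length U a b V))

  nd1 : ¬ DescF k (suc k) (ins W)
  nd1 d = C.no-desc₁ (Desc-insGo⁻ (suc (suc k)) Fab V invFab (NP.m<n⇒m<1+n (NP.n<1+n k)) (subst (DescF k (suc k)) eW d))

  nd2 : ¬ DescF (suc k) k (ins W)
  nd2 d = C.no-desc₂ (Desc-insGo⁻ (suc (suc k)) Fab V invFab (NP.n<1+n (suc k)) (subst (DescF (suc k) k) eW d))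

  eqF : ins W' ≡ mapQ (swapN k (suc k)) (ins W)
  eqF = trans eW' (trans (cong (λ G → insGo (suc (suc k)) G V) C.commute)
         (trans (Relabel.insGo-mapQ (swapN k (suc k)) (suc (suc k)) Fab V (σ-fixes-beyond k))
                (cong (mapQ (swapN k (suc k))) (sym eW))))

-- Q-labels record positions in the word, so W' can be read off ins W'.
swapped-word : ∀ U a b V W' → ins W' ≡ mapQ (swapN (suc (length U)) (suc (suc (length U)))) (ins (U ++ a ∷ b ∷ V)) →
         W' ≡ U ++ b ∷ a ∷ V
swapped-word U a b V W' eq = nth-ext W' Y pointwise
  where
  l = length U
  W = U ++ a ∷ b ∷ V
  Y = U ++ b ∷ a ∷ V
  σ' = swapN (suc l) (suc (suc l))
  τ = swapN l (suc l)

  W'⇒Y : ∀ j p → nth W' j ≡ just p → nth Y j ≡ just p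
  W'⇒Y j p e with ∈-nodes-mapQ⁻ σ' (ins W) (subst (λ G → (suc j , p) ∈ nodesF G) eq (∈-nodes-ins⁺ W' (j , refl , e)))
  ... | q' , m3 , e3 with ∈-nodes-ins⁻ W m3
  ... | i'' , refl , e5 =
    let j≡ : j ≡ τ i''
        j≡ = NP.suc-injective (trans e3 (swap-suc l i''))
    in trans (cong (nth Y) j≡) (trans (sym (nth-swap U a b V (τ i''))) (trans (cong (nth W) (swap-inv l i'')) e5))

  Y⇒W' : ∀ j p → nth Y j ≡ just p → nth W' j ≡ just p
  Y⇒W' j p e with ∈-nodes-ins⁻ W' (subst (λ G → (σ' (suc (τ j)) , p) ∈ nodesF G) (sym eq)
                     (∈-nodes-mapQ⁺ σ' (ins W) (∈-nodes-ins⁺ W (τ j , refl , trans (nth-swap U a b V j) e))))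
  ... | i0 , e0 , e1 =
    let i0≡ : i0 ≡ j
        i0≡ = NP.suc-injective (trans (sym e0) (trans (swap-suc l (τ j)) (cong suc (swap-inv l j))))
    in trans (cong (nth W') (sym i0≡)) e1

  pointwise : ∀ j → nth W' j ≡ nth Y j
  pointwise j with nth W' j in e1 | nth Y j in e2
  ... | just p | _ = trans (sym (W'⇒Y j p e1)) e2
  ... | nothing | just p = trans (sym e1) (Y⇒W' j p e2)
  ... | nothing | nothing = refl

∼⇒separatedSwap-at : ∀ U a b V W' → Unique (U ++ a ∷ b ∷ V) →
  ¬ DescF (suc (suc (length U))) (suc (length U)) (ins (U ++ a ∷ b ∷ V)) →
  ins W' ≡ mapQ (swapN (suc (length U)) (suc (suc (length U)))) (ins (U ++ a ∷ b ∷ V)) →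
  SeparatedSwap (U ++ a ∷ b ∷ V) W'
∼⇒separatedSwap-at U a b V W' u nd eq with Dichotomy.dichotomy (ins U) (suc (length U)) a b (ins-wellFormed U) (Unique⇒≢ U u)
... | inj₁ d = ⊥-elim (nd (subst (DescF (suc (suc (length U))) (suc (length U))) (sym (ins-++ U a b V))
                 (Desc-insGo⁺ (suc (suc (suc (length U)))) _ V
                   (step-wellFormed b (suc (suc (length U))) _ (step-wellFormed a (suc (length U)) (ins U) (ins-wellFormed U))) d)))
... | inj₂ (sepCell f ff before after pa pb ne) =
  let (r₁ , r₂ , p₁ , p₂ , h , ha , hb) = Rootlist.cell⇒rootlist (ins U) (ins-wellFormed U) a b dxa f ff pa pb
  in U , V , a , b , refl , swapped-word U a b V W' eq , r₁ , r₂ , p₁ , p₂ , h , inj₁ (ha , hb)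
  where
  dxa : ∀ {c} → c ∈ ins U → ¬ (lab c ≡ a)
  dxa mc e = Unique⇒∉prefix U u (subst (_∈ U) e (root-label∈word U mc))
... | inj₂ (sepCell f ff after before pa pb ne) =
  let (r₁ , r₂ , p₁ , p₂ , h , hb , ha) = Rootlist.cell⇒rootlist (ins U) (ins-wellFormed U) b a dxb f ff pb pa
  in U , V , a , b , refl , swapped-word U a b V W' eq , r₁ , r₂ , p₁ , p₂ , h , inj₂ (hb , ha)
  where
  dxb : ∀ {c} → c ∈ ins U → ¬ (lab c ≡ b)
  dxb mc e = Unique⇒∉prefix₂ U u (subst (_∈ U) e (root-label∈word U mc))
... | inj₂ (sepCell _ _ before before _ _ ne) = ⊥-elim (ne refl)
... | inj₂ (sepCell _ _ after after _ _ ne) = ⊥-elim (ne refl)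

∼⇒separatedSwap : ∀ W W' → Unique W → W ∼ W' → SeparatedSwap W W'
∼⇒separatedSwap W W' uW (k , kIn , k1In , nd1 , nd2 , eq) with ∈-qlabelsF⇒node (ins W) kIn | ∈-qlabelsF⇒node (ins W) k1In
... | pa , ma | pb , mb with ∈-nodes-ins⁻ W ma | ∈-nodes-ins⁻ W mb
... | i , refl , ea | i' , e' , eb with NP.suc-injective (sym e')
... | refl with nth-split W i ea eb
... | U , V , refl , refl = ∼⇒separatedSwap-at U pa pb V W' uW nd2 eq

proposition5p8 : (W W' : List Letter) → Unique W → Unique W' →
    (W ∼ W') ⇔
    (∃ λ U → ∃ λ V → ∃ λ a → ∃ λ b →
        (W ≡ U ++ (a ∷ b ∷ V)) × (W' ≡ U ++ (b ∷ a ∷ V))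
      × (∃ λ r₁ → ∃ λ r₂ → InRL U r₁ × InRL U r₂ × (r₁ <E r₂)
          × (((over a <E r₁) × (r₂ <E over b)) ⊎ ((over b <E r₁) × (r₂ <E over a)))))
proposition5p8 W W' uW _ = mk⇔ (∼⇒separatedSwap W W' uW) (separatedSwap⇒∼ W W')
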